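{- Let $f:\mathbb{N}\to\mathbb{C}$ be an arbitrary arithmetic function, let $P(x)$ be a polynomial with integer coefficients, and let $n\in\mathbb{N}$. Then \[ \sum_{\substack{a=1\\ (a,n)=1}}^{n} f\big((P(a),n)\big)=\varphi(n)\sum_{d\mid n}\frac{(\mu*f)(d)}{\varphi(d)}\,N_P(d), \] where $N_P(d)$ is the number of incongruent solutions $x \pmod d$ of the congruence $P(x)\equiv 0\pmod d$ such that $(x,d)=1$.
   Context: $(x,y)$ denotes the greatest common divisor (with $(0,n)=n$). $\varphi$ is Euler's totient function, $\mu$ is the Möbius function and $(\mu*f)(m)=\sum_{k\mid m}\mu(k)f(m/k)$ is the Dirichlet convolution. -}

module Defs where

open import Level using (Level)
open import Data.Nat using (ℕ; zero; suc; _≟_)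
import Data.Nat as ℕ
open import Data.Nat.DivMod using (_/_)
open import Data.Nat.GCD using (gcd)
open import Data.Nat.Divisibility using (_∣_; _∣?_)
open import Data.Nat.Primality using (Prime; prime?)
open import Data.Integer as ℤ using (ℤ; +_; -[1+_]; ∣_∣)
open import Data.List using (List; []; _∷_; map; filter; length; upTo; foldr)
open import Data.Product using (_×_)
open import Relation.Nullary.Decidable using (_×-dec_)
open import Algebra.Bundles using (CommutativeRing)

range1 : ℕ → List ℕ
range1 n = map suc (upTo n)

divisors : ℕ → List ℕ
divisors n = filter (λ d → d ∣? n) (range1 n)

φ : ℕ → ℕ
φ n = length (filter (λ a → gcd a n ≟ 1) (range1 n))

-- exact natural-number quotient (used only with a nonzero divisor that divides)
divℕ : ℕ → ℕ → ℕ
divℕ m zero    = zero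
divℕ m (suc k) = m / suc k

primeDivisors : ℕ → List ℕ
primeDivisors n = filter (λ p → prime? p ×-dec (p ∣? n)) (range1 n)

squareDivisorsGt1 : ℕ → List ℕ
squareDivisorsGt1 n = filter (λ d → d ℕ.* d ∣? n) (map suc (range1 n))

negOnePow : ℕ → ℤ
negOnePow zero    = + 1
negOnePow (suc k) = ℤ.- negOnePow k

μ : ℕ → ℤ
μ n with squareDivisorsGt1 n
... | []    = negOnePow (length (primeDivisors n))
... | _ ∷ _ = + 0

-- integer polynomial given by its coefficient list c₀ ∷ c₁ ∷ … (ascending degree)
evalPoly : List ℤ → ℤ → ℤ
evalPoly []       x = + 0
evalPoly (c ∷ cs) x = c ℤ.+ x ℤ.* evalPoly cs x

NP : List ℤ → ℕ → ℕ
NP P d = length (filter (λ x → (d ∣? ∣ evalPoly P (+ x) ∣) ×-dec (gcd x d ≟ 1)) (upTo d))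

module _ {c ℓ : Level} (R : CommutativeRing c ℓ) where
  open CommutativeRing R

  sumR : List Carrier → Carrier
  sumR = foldr _+_ 0#

  natR : ℕ → Carrier
  natR zero    = 0#
  natR (suc k) = 1# + natR k

  intR : ℤ → Carrier
  intR (+ k)      = natR k
  intR -[1+ k ]   = - natR (suc k)

  μconv : (ℕ → Carrier) → ℕ → Carrier
  μconv f m = sumR (map (λ k → intR (μ k) * f (divℕ m k)) (divisors m))

{-# OPTIONS --safe #-}
module Submission where

-- By Möbius inversion f((P(a),n)) = ∑_{e ∣ (P(a),n)} (μ*f)(e), so after exchanging the sums
-- (μ*f)(e) is weighted by the number of units a mod n with e ∣ P(a).  Since P(a) mod e
-- depends only on a mod e, that number is ∑ F(x) over the roots x mod e of P, where F(x)
-- counts the units a mod n with a ≡ x (mod e).  F vanishes off the units mod e and is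
-- constant, say K, on them: refining the modulus from e to ep (p prime), a unit x mod e has
-- p lifts te + x (t mod p) that are units mod ep if p ∣ e, and p − 1 if p ∤ e, because
-- te + x ≡ 0 (mod p) then has exactly one solution t.  Counting all units gives
-- φ(n) = φ(e)K, so the weight is (φ(n)/φ(e)) N_P(e).

open import Defs

open import Algebra.Bundles using (CommutativeSemiring; CommutativeRing)
import Algebra.Properties.CommutativeSemigroup as CommutativeSemigroupProperties
open import Data.Empty using (⊥-elim)
open import Data.Integer as ℤ using (ℤ; +_; ∣_∣)
import Data.Integer.Divisibility.Signed as ℤ∣
import Data.Integer.Properties as ℤ
import Data.Integer.Tactic.RingSolver as ℤ-Solver
open import Data.List using (List; []; _∷_; map; filter; foldr; length; upTo; applyUpTo)
open import Data.List.Membership.Propositional using (_∈_)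
open import Data.List.Membership.Propositional.Properties
  using (∈-filter⁺; ∈-filter⁻; ∈-map⁺; ∈-map⁻; ∈-upTo⁺)
open import Data.List.Relation.Unary.All using (All; _∷_)
open import Data.List.Relation.Unary.Any using (here)
open import Data.Nat as ℕ using (ℕ; zero; suc; _<_; _≤_; z≤n; s≤s; NonZero; _≟_)
open import Data.Nat.Coprimality as Coprime using (Coprime; coprime-divisor; gcd≡1⇒coprime; coprime⇒gcd≡1)
open import Data.Nat.Divisibility
  using ( _∣_; _∣?_; divides; ∣-refl; ∣-trans; ∣-antisym; ∣⇒≤; 0∣⇒≡0; m∣m*n; n∣m*n; ∣m⇒∣m*n; ∣n⇒∣m*n
        ; ∣m+n∣m⇒∣n; ∣m∣n⇒∣m+n; *-monoʳ-∣; *-pres-∣; *-cancelˡ-∣; m*n∣o⇒n∣o/m; quotient≢0)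
open import Data.Nat.DivMod
  using ( _%_; _/_; m%n<n; m<n⇒m%n≡m; m≡m%n+[m/n]*n; [m+kn]%n≡m%n; m∣n⇒o%n%m≡o%m
        ; m*n/n≡m; m/n*n≡m; m*[n/m]≡n; m/n≤m; n/n≡1)
open import Data.Nat.GCD
  using (gcd; module Bézout; gcd[m,n]∣m; gcd[m,n]∣n; gcd-greatest; gcd[m,n]≤n; gcd[m,n]≢0; gcd-zeroˡ; gcd-identityˡ)
open import Data.Nat.ListAction using (product)
open import Data.Nat.Primality
  using (Prime; prime; prime?; ¬prime[1]; prime⇒irreducible; prime⇒nonZero; prime⇒nonTrivial; euclidsLemma)
open import Data.Nat.Primality.Factorisation using (factorise; PrimeFactorisation; factors)
import Data.Nat.Properties as ℕ
import Data.Nat.Tactic.RingSolver as ℕ-Solver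
open import Data.Product using (_×_; _,_; ∃-syntax; proj₁; proj₂; uncurry)
open import Data.Sum using (_⊎_; inj₁; inj₂; [_,_])
open import Function using (_∘_; flip)
open import Function.Bundles using (_⇔_; mk⇔; Equivalence)
open import Level using (Level)
open import Relation.Binary.PropositionalEquality as ≡ using (_≡_; _≢_)
import Relation.Binary.Reasoning.Setoid as SetoidReasoning
open import Relation.Nullary using (Dec; yes; no; ¬_; ¬?; _×-dec_)

-- Divisibility and exact division

m∣n<m⇒n≡0 : ∀ {m n} → m ∣ n → n < m → n ≡ 0
m∣n<m⇒n≡0 {n = zero}  _   _   = ≡.refl
m∣n<m⇒n≡0 {n = suc _} m∣n n<m = ⊥-elim (ℕ.<⇒≱ n<m (∣⇒≤ m∣n))

∣⇒nonZero : ∀ {m n} .{{_ : NonZero n}} → m ∣ n → NonZero m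
∣⇒nonZero {zero}  {n} 0∣n = ⊥-elim (ℕ.≢-nonZero⁻¹ n (0∣⇒≡0 0∣n))
∣⇒nonZero {suc _}     _   = _

[te+r]%e≡r : ∀ t e r .{{_ : NonZero e}} → r < e → (t ℕ.* e ℕ.+ r) % e ≡ r
[te+r]%e≡r t e r r<e = ≡.trans (≡.cong (_% e) (ℕ.+-comm (t ℕ.* e) r))
                               (≡.trans ([m+kn]%n≡m%n r t e) (m<n⇒m%n≡m r<e))

gcd[n,n]≡gcd[0,n] : ∀ n → gcd n n ≡ gcd 0 n
gcd[n,n]≡gcd[0,n] n =
  ≡.trans (∣-antisym (gcd[m,n]∣m n n) (gcd-greatest ∣-refl ∣-refl)) (≡.sym (gcd-identityˡ n))

divℕ≡/ : ∀ m k .{{_ : NonZero k}} → divℕ m k ≡ m / k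
divℕ≡/ m (suc _) = ≡.refl

divℕ-*ˡ : ∀ k m .{{_ : NonZero k}} → divℕ (k ℕ.* m) k ≡ m
divℕ-*ˡ k m = ≡.trans (divℕ≡/ (k ℕ.* m) k) (≡.trans (≡.cong (_/ k) (ℕ.*-comm k m)) (m*n/n≡m m k))

*-divℕ : ∀ {k m} → k ∣ m → k ℕ.* divℕ m k ≡ m
*-divℕ {zero}  0∣m = ≡.sym (0∣⇒≡0 0∣m)
*-divℕ {suc _} k∣m = m*[n/m]≡n k∣m

divℕ-∣ : ∀ {k m} → k ∣ m → divℕ m k ∣ m
divℕ-∣ {k} {m} k∣m = ≡.subst (divℕ m k ∣_) (*-divℕ k∣m) (n∣m*n k)

divℕ-≤ : ∀ m k → divℕ m k ≤ m
divℕ-≤ m zero    = z≤n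
divℕ-≤ m (suc k) = m/n≤m m (suc k)

divℕ-nonZero : ∀ {k m} .{{_ : NonZero m}} → k ∣ m → NonZero (divℕ m k)
divℕ-nonZero k∣m = ∣⇒nonZero (divℕ-∣ k∣m)

divℕ-self : ∀ m .{{_ : NonZero m}} → divℕ m m ≡ 1
divℕ-self m = ≡.trans (divℕ≡/ m m) (n/n≡1 m)

divℕ≡1⇒≡ : ∀ {k m} → k ∣ m → divℕ m k ≡ 1 → k ≡ m
divℕ≡1⇒≡ {k} {m} k∣m m/k≡1 = begin
  k                 ≡⟨ ℕ.*-identityʳ k ⟨
  k ℕ.* 1           ≡⟨ ≡.cong (k ℕ.*_) m/k≡1 ⟨
  k ℕ.* divℕ m k    ≡⟨ *-divℕ k∣m ⟩
  m                 ∎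
  where open ≡.≡-Reasoning

∣divℕ-swap : ∀ {m k j} .{{_ : NonZero m}} → (k ∣ m) × (j ∣ divℕ m k) → (j ∣ m) × (k ∣ divℕ m j)
∣divℕ-swap {m} {k} {j} (k∣m , j∣m/k) = j∣m , k∣m/j
  where
  jk∣m : j ℕ.* k ∣ m
  jk∣m = ≡.subst₂ _∣_ (ℕ.*-comm k j) (*-divℕ k∣m) (*-monoʳ-∣ k j∣m/k)
  j∣m : j ∣ m
  j∣m = ∣-trans (m∣m*n k) jk∣m
  instance _ = ∣⇒nonZero j∣m
  k∣m/j : k ∣ divℕ m j
  k∣m/j = ≡.subst (k ∣_) (≡.sym (divℕ≡/ m j)) (m*n∣o⇒n∣o/m j k jk∣m)

-- Coprimality, primes and linear congruences

coprime-∣ʳ : ∀ {a b c} → Coprime a b → c ∣ b → Coprime a c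
coprime-∣ʳ a⊥b c∣b (d∣a , d∣c) = a⊥b (d∣a , ∣-trans d∣c c∣b)

coprime-*ʳ : ∀ {a b c} → Coprime a b → Coprime a c → Coprime a (b ℕ.* c)
coprime-*ʳ {a} {b} a⊥b a⊥c {d} (d∣a , d∣bc) = a⊥c (d∣a , coprime-divisor d⊥b d∣bc)
  where
  d⊥b : Coprime d b
  d⊥b (i∣d , i∣b) = a⊥b (∣-trans i∣d d∣a , i∣b)

coprime-+* : ∀ t e x → Coprime x e ⇔ Coprime (t ℕ.* e ℕ.+ x) e
coprime-+* t e x = mk⇔
  (λ x⊥e {_} (d∣te+x , d∣e) → x⊥e (∣m+n∣m⇒∣n d∣te+x (∣n⇒∣m*n t d∣e) , d∣e))
  (λ te+x⊥e {_} (d∣x , d∣e) → te+x⊥e (∣m∣n⇒∣m+n (∣n⇒∣m*n t d∣e) d∣x , d∣e))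

prime∤⇒coprime : ∀ {p a} → Prime p → ¬ p ∣ a → Coprime a p
prime∤⇒coprime p-prime p∤a (d∣a , d∣p) with prime⇒irreducible p-prime d∣p
... | inj₁ d≡1    = d≡1
... | inj₂ ≡.refl = ⊥-elim (p∤a d∣a)

coprime⇒prime∤ : ∀ {p a} → Prime p → Coprime a p → ¬ p ∣ a
coprime⇒prime∤ {p} p-prime a⊥p p∣a with a⊥p (p∣a , ∣-refl)
coprime⇒prime∤ (prime ⦃ () ⦄ _) a⊥p p∣a | ≡.refl

primeFactor : ∀ m → .{{ℕ.NonTrivial m}} → ∃[ p ] Prime p × p ∣ m
primeFactor m@(suc (suc _)) with factorise m
... | record { factors = [] ; isFactorisation = () }
... | record { factors = p ∷ ps ; isFactorisation = m≡∏ ; factorsPrime = p-prime ∷ _ } =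
  p , p-prime , divides (product ps) (≡.trans m≡∏ (ℕ.*-comm p (product ps)))

linearCongruence-solvable : ∀ {p e} x → Prime p → ¬ p ∣ e → ∃[ t ] p ∣ t ℕ.* e ℕ.+ x
linearCongruence-solvable {zero} x (prime ⦃ () ⦄ _) _
linearCongruence-solvable {p@(suc p′)} {e} x p-prime p∤e
  with Coprime.coprime-Bézout (prime∤⇒coprime p-prime p∤e)
... | Bézout.-+ u v 1+ue≡vp = x ℕ.* u , ≡.subst (p ∣_) (≡.sym xue+x≡xvp) (∣n⇒∣m*n x (n∣m*n v))
  where
  xue+x≡xvp : x ℕ.* u ℕ.* e ℕ.+ x ≡ x ℕ.* (v ℕ.* p)
  xue+x≡xvp = ≡.trans (factor x u e) (≡.cong (x ℕ.*_) 1+ue≡vp)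
    where
    factor : ∀ x u e → x ℕ.* u ℕ.* e ℕ.+ x ≡ x ℕ.* (1 ℕ.+ u ℕ.* e)
    factor = ℕ-Solver.solve-∀
... | Bézout.+- u v 1+vp≡ue =
  p′ ℕ.* x ℕ.* u , ≡.subst (p ∣_) (≡.sym p′xue+x≡) (n∣m*n (x ℕ.+ p′ ℕ.* x ℕ.* v))
  where
  open ≡.≡-Reasoning
  regroup : ∀ p′ x u e → p′ ℕ.* x ℕ.* u ℕ.* e ℕ.+ x ≡ p′ ℕ.* x ℕ.* (u ℕ.* e) ℕ.+ x
  regroup = ℕ-Solver.solve-∀
  factor : ∀ p′ x v → p′ ℕ.* x ℕ.* (1 ℕ.+ v ℕ.* suc p′) ℕ.+ x ≡ (x ℕ.+ p′ ℕ.* x ℕ.* v) ℕ.* suc p′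
  factor = ℕ-Solver.solve-∀
  p′xue+x≡ : p′ ℕ.* x ℕ.* u ℕ.* e ℕ.+ x ≡ (x ℕ.+ p′ ℕ.* x ℕ.* v) ℕ.* p
  p′xue+x≡ = begin
    p′ ℕ.* x ℕ.* u ℕ.* e ℕ.+ x            ≡⟨ regroup p′ x u e ⟩
    p′ ℕ.* x ℕ.* (u ℕ.* e) ℕ.+ x          ≡⟨ ≡.cong (λ w → p′ ℕ.* x ℕ.* w ℕ.+ x) 1+vp≡ue ⟨
    p′ ℕ.* x ℕ.* (1 ℕ.+ v ℕ.* p) ℕ.+ x    ≡⟨ factor p′ x v ⟩
    (x ℕ.+ p′ ℕ.* x ℕ.* v) ℕ.* p          ∎

linearCongruence-unique : ∀ {p e x t t′} → Coprime p e → t ≤ t′ → t′ < p →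
                          p ∣ t ℕ.* e ℕ.+ x → p ∣ t′ ℕ.* e ℕ.+ x → t ≡ t′
linearCongruence-unique {p} {e} {x} {t} {t′} p⊥e t≤t′ t′<p p∣te+x p∣t′e+x =
  ≡.trans (≡.sym (ℕ.+-identityʳ t)) (≡.trans (≡.cong (t ℕ.+_) (≡.sym d≡0)) (ℕ.m+[n∸m]≡n t≤t′))
  where
  d = t′ ℕ.∸ t
  t′e+x≡ : t′ ℕ.* e ℕ.+ x ≡ (t ℕ.* e ℕ.+ x) ℕ.+ e ℕ.* d
  t′e+x≡ = ≡.trans (≡.cong (λ s → s ℕ.* e ℕ.+ x) (≡.sym (ℕ.m+[n∸m]≡n t≤t′))) (expand t d e x)
    where
    expand : ∀ t d e x → (t ℕ.+ d) ℕ.* e ℕ.+ x ≡ (t ℕ.* e ℕ.+ x) ℕ.+ e ℕ.* d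
    expand = ℕ-Solver.solve-∀
  p∣d : p ∣ d
  p∣d = coprime-divisor p⊥e (∣m+n∣m⇒∣n (≡.subst (p ∣_) t′e+x≡ p∣t′e+x) p∣te+x)
  d≡0 : d ≡ 0
  d≡0 = m∣n<m⇒n≡0 p∣d (ℕ.≤-<-trans (ℕ.m∸n≤m t′ t) t′<p)

-- Integer polynomials modulo e

evalPoly-shift : ∀ P (y k m : ℤ) → ∃[ Q ] evalPoly P (y ℤ.+ k ℤ.* m) ≡ evalPoly P y ℤ.+ m ℤ.* Q
evalPoly-shift []       y k m = + 0 , ≡.sym (≡.trans (ℤ.+-identityˡ _) (ℤ.*-zeroʳ m))
evalPoly-shift (c ∷ cs) y k m with evalPoly-shift cs y k m
... | Q , Pcs≡ = y ℤ.* Q ℤ.+ k ℤ.* evalPoly cs y ℤ.+ k ℤ.* m ℤ.* Q , (begin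
  c ℤ.+ (y ℤ.+ k ℤ.* m) ℤ.* evalPoly cs (y ℤ.+ k ℤ.* m)
    ≡⟨ ≡.cong (λ v → c ℤ.+ (y ℤ.+ k ℤ.* m) ℤ.* v) Pcs≡ ⟩
  c ℤ.+ (y ℤ.+ k ℤ.* m) ℤ.* (evalPoly cs y ℤ.+ m ℤ.* Q)
    ≡⟨ expand c y k m (evalPoly cs y) Q ⟩
  (c ℤ.+ y ℤ.* evalPoly cs y) ℤ.+ m ℤ.* (y ℤ.* Q ℤ.+ k ℤ.* evalPoly cs y ℤ.+ k ℤ.* m ℤ.* Q) ∎)
  where
  open ≡.≡-Reasoning
  expand : ∀ c y k m B Q → c ℤ.+ (y ℤ.+ k ℤ.* m) ℤ.* (B ℤ.+ m ℤ.* Q)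
                         ≡ (c ℤ.+ y ℤ.* B) ℤ.+ m ℤ.* (y ℤ.* Q ℤ.+ k ℤ.* B ℤ.+ k ℤ.* m ℤ.* Q)
  expand = ℤ-Solver.solve-∀

∣evalPoly-mod : ∀ P {a b} k e → a ≡ b ℕ.+ k ℕ.* e →
                (e ∣ ∣ evalPoly P (+ a) ∣) ⇔ (e ∣ ∣ evalPoly P (+ b) ∣)
∣evalPoly-mod P {a} {b} k e a≡b+ke = mk⇔
  (λ e∣Pa → ℤ∣.∣⇒∣ᵤ (ℤ∣.∣m+n∣n⇒∣m {m = Pb} (≡.subst (+ e ℤ∣.∣_) Pa≡ (ℤ∣.∣ᵤ⇒∣ e∣Pa)) e∣eQ))
  (λ e∣Pb → ℤ∣.∣⇒∣ᵤ (≡.subst (+ e ℤ∣.∣_) (≡.sym Pa≡)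
                        (ℤ∣.∣m∣n⇒∣m+n (ℤ∣.∣ᵤ⇒∣ {i = Pb} e∣Pb) e∣eQ)))
  where
  Pb = evalPoly P (+ b)
  shift = evalPoly-shift P (+ b) (+ k) (+ e)
  Q = proj₁ shift
  a≡ : + a ≡ + b ℤ.+ + k ℤ.* + e
  a≡ = ≡.trans (≡.cong +_ a≡b+ke) (≡.trans (ℤ.pos-+ b (k ℕ.* e)) (≡.cong (λ v → + b ℤ.+ v) (ℤ.pos-* k e)))
  Pa≡ : evalPoly P (+ a) ≡ Pb ℤ.+ + e ℤ.* Q
  Pa≡ = ≡.trans (≡.cong (evalPoly P) a≡) (proj₂ shift)
  e∣eQ : + e ℤ∣.∣ + e ℤ.* Q
  e∣eQ = ℤ∣.∣m⇒∣m*n Q ℤ∣.∣-refl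

-- Square-free numbers and the Möbius function

SquareFree : ℕ → Set
SquareFree n = ∀ d → 2 ≤ d → ¬ d ℕ.* d ∣ n

∈squareDivisorsGt1⁺ : ∀ {n d} .{{_ : NonZero n}} → 2 ≤ d → d ℕ.* d ∣ n → d ∈ squareDivisorsGt1 n
∈squareDivisorsGt1⁺ {d = 0}                () _
∈squareDivisorsGt1⁺ {d = 1}                (s≤s ()) _
∈squareDivisorsGt1⁺ {n} {d@(suc (suc i))} _ d²∣n =
  ∈-filter⁺ (λ k → k ℕ.* k ∣? n) (∈-map⁺ suc (∈-map⁺ suc (∈-upTo⁺ i<n))) d²∣n
  where
  i<n : i < n
  i<n = ℕ.≤-trans (ℕ.n≤1+n (suc i)) (ℕ.≤-trans (ℕ.m≤m*n d d) (∣⇒≤ d²∣n))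

∈squareDivisorsGt1⁻ : ∀ {n d} → d ∈ squareDivisorsGt1 n → 2 ≤ d × d ℕ.* d ∣ n
∈squareDivisorsGt1⁻ {n} d∈ with ∈-filter⁻ (λ k → k ℕ.* k ∣? n) {xs = map suc (range1 n)} d∈
... | d∈range , d²∣n with ∈-map⁻ suc d∈range
...   | _ , i+1∈range , ≡.refl with ∈-map⁻ suc i+1∈range
...     | _ , _ , ≡.refl = s≤s (s≤s z≤n) , d²∣n

μ-squareFree : ∀ {n} → SquareFree n → μ n ≡ negOnePow (length (primeDivisors n))
μ-squareFree {n} sf with squareDivisorsGt1 n in eq
... | []    = ≡.refl
... | d ∷ _ = ⊥-elim (uncurry (sf d) (∈squareDivisorsGt1⁻ (≡.subst (d ∈_) (≡.sym eq) (here ≡.refl))))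

μ-square : ∀ {n d} .{{_ : NonZero n}} → 2 ≤ d → d ℕ.* d ∣ n → μ n ≡ + 0
μ-square {n} 2≤d d²∣n with squareDivisorsGt1 n in eq | ∈squareDivisorsGt1⁺ 2≤d d²∣n
... | _ ∷ _ | _  = ≡.refl
... | []    | ()

μ-*prime-∣ : ∀ {p j} → Prime p → p ∣ j → .{{_ : NonZero j}} → μ (p ℕ.* j) ≡ + 0
μ-*prime-∣ {p} {j} p-prime p∣j = μ-square ⦃ ℕ.m*n≢0 p j ⦄ (ℕ.nonTrivial⇒n>1 p) (*-monoʳ-∣ p p∣j)
  where instance _ = prime⇒nonZero p-prime
                 _ = prime⇒nonTrivial p-prime

squareFree⊎square : ∀ n .{{_ : NonZero n}} → SquareFree n ⊎ ∃[ d ] 2 ≤ d × d ℕ.* d ∣ n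
squareFree⊎square n with squareDivisorsGt1 n in eq
... | []    = inj₁ (λ d 2≤d d²∣n → ∉[] (≡.subst (d ∈_) eq (∈squareDivisorsGt1⁺ 2≤d d²∣n)))
  where
  ∉[] : ∀ {d} → ¬ d ∈ []
  ∉[] ()
... | d ∷ _ = inj₂ (d , ∈squareDivisorsGt1⁻ (≡.subst (d ∈_) (≡.sym eq) (here ≡.refl)))

squareFree-*prime : ∀ {p j} → Prime p → ¬ p ∣ j → SquareFree j → SquareFree (p ℕ.* j)
squareFree-*prime {p} {j} p-prime p∤j j-sf d 2≤d d²∣pj with p ∣? d
... | yes p∣d = p∤j (*-cancelˡ-∣ p ⦃ prime⇒nonZero p-prime ⦄ (∣-trans (*-pres-∣ p∣d p∣d) d²∣pj))
... | no  p∤d = j-sf d 2≤d (coprime-divisor (Coprime.sym (coprime-*ʳ p⊥d p⊥d)) d²∣pj)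
  where p⊥d = Coprime.sym (prime∤⇒coprime p-prime p∤d)

module FiniteSums {c ℓ : Level} (S : CommutativeSemiring c ℓ) where
  open CommutativeSemiring S renaming (Carrier to C)
  open SetoidReasoning setoid
  open CommutativeSemigroupProperties +-commutativeSemigroup using (interchange)

  ∑< : ℕ → (ℕ → C) → C
  ∑< zero    F = 0#
  ∑< (suc n) F = ∑< n F + F n

  syntax ∑< n (λ i → F) = ∑[ i < n ] F

  infixr 8 [_]·_

  [_]·_ : {P : Set} → Dec P → C → C
  [ yes _ ]· v = v
  [ no _  ]· v = 0#

  listSum : {A : Set} → List A → (A → C) → C
  listSum xs F = foldr _+_ 0# (map F xs)

  ∑<-cong : ∀ n {F G : ℕ → C} → (∀ i → i < n → F i ≈ G i) → ∑< n F ≈ ∑< n G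
  ∑<-cong zero    F≈G = refl
  ∑<-cong (suc n) F≈G =
    +-cong (∑<-cong n (λ i i<n → F≈G i (ℕ.m<n⇒m<1+n i<n))) (F≈G n (ℕ.n<1+n n))

  ∑<-zeros : ∀ n {F : ℕ → C} → (∀ i → i < n → F i ≈ 0#) → ∑< n F ≈ 0#
  ∑<-zeros zero    F≈0 = refl
  ∑<-zeros (suc n) F≈0 =
    trans (+-cong (∑<-zeros n (λ i i<n → F≈0 i (ℕ.m<n⇒m<1+n i<n))) (F≈0 n (ℕ.n<1+n n)))
          (+-identityˡ 0#)

  ∑<-+ : ∀ n (F G : ℕ → C) → ∑[ i < n ] (F i + G i) ≈ ∑< n F + ∑< n G
  ∑<-+ zero    F G = sym (+-identityˡ 0#)
  ∑<-+ (suc n) F G = trans (+-congʳ (∑<-+ n F G)) (interchange _ _ _ _)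

  ∑<-*ˡ : ∀ n a (F : ℕ → C) → ∑[ i < n ] (a * F i) ≈ a * ∑< n F
  ∑<-*ˡ zero    a F = sym (zeroʳ a)
  ∑<-*ˡ (suc n) a F = trans (+-congʳ (∑<-*ˡ n a F)) (sym (distribˡ a _ _))

  ∑<-*ʳ : ∀ n a (F : ℕ → C) → ∑[ i < n ] (F i * a) ≈ ∑< n F * a
  ∑<-*ʳ n a F = trans (∑<-cong n (λ i _ → *-comm (F i) a)) (trans (∑<-*ˡ n a F) (*-comm a _))

  ∑<-swap : ∀ n m (H : ℕ → ℕ → C) → ∑[ i < n ] ∑[ j < m ] H i j ≈ ∑[ j < m ] ∑[ i < n ] H i j
  ∑<-swap zero    m H = sym (∑<-zeros m (λ _ _ → refl))
  ∑<-swap (suc n) m H = trans (+-congʳ (∑<-swap n m H)) (sym (∑<-+ m _ (H n)))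

  ∑<-split : ∀ a b (F : ℕ → C) → ∑< (a ℕ.+ b) F ≈ ∑< a F + ∑[ i < b ] F (a ℕ.+ i)
  ∑<-split a zero    F =
    trans (reflexive (≡.cong (λ k → ∑< k F) (ℕ.+-identityʳ a))) (sym (+-identityʳ _))
  ∑<-split a (suc b) F = begin
    ∑< (a ℕ.+ suc b) F                                ≡⟨ ≡.cong (λ k → ∑< k F) (ℕ.+-suc a b) ⟩
    ∑< (a ℕ.+ b) F + F (a ℕ.+ b)                      ≈⟨ +-congʳ (∑<-split a b F) ⟩
    (∑< a F + ∑[ i < b ] F (a ℕ.+ i)) + F (a ℕ.+ b)   ≈⟨ +-assoc _ _ _ ⟩
    ∑< a F + ∑[ i < suc b ] F (a ℕ.+ i)               ∎

  ∑<-shift : ∀ n (F : ℕ → C) → ∑< (suc n) F ≈ F 0 + ∑[ i < n ] F (suc i)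
  ∑<-shift n F = trans (∑<-split 1 n F) (+-congʳ (+-identityˡ _))

  ∑<-rotate : ∀ n (G : ℕ → C) → G n ≈ G 0 → ∑[ i < n ] G (suc i) ≈ ∑< n G
  ∑<-rotate zero    G _       = refl
  ∑<-rotate (suc n) G Gn≈G0 = begin
    ∑[ i < n ] G (suc i) + G (suc n)  ≈⟨ +-congˡ Gn≈G0 ⟩
    ∑[ i < n ] G (suc i) + G 0        ≈⟨ +-comm _ _ ⟩
    G 0 + ∑[ i < n ] G (suc i)        ≈⟨ sym (∑<-shift n G) ⟩
    ∑< (suc n) G                      ∎

  ∑<-blocks : ∀ q e (G : ℕ → C) → ∑< (q ℕ.* e) G ≈ ∑[ t < q ] ∑[ r < e ] G (t ℕ.* e ℕ.+ r)
  ∑<-blocks zero    e G = refl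
  ∑<-blocks (suc q) e G = begin
    ∑< (e ℕ.+ q ℕ.* e) G                            ≡⟨ ≡.cong (λ k → ∑< k G) (ℕ.+-comm e (q ℕ.* e)) ⟩
    ∑< (q ℕ.* e ℕ.+ e) G                            ≈⟨ ∑<-split (q ℕ.* e) e G ⟩
    ∑< (q ℕ.* e) G + ∑[ r < e ] G (q ℕ.* e ℕ.+ r)   ≈⟨ +-congʳ (∑<-blocks q e G) ⟩
    ∑[ t < suc q ] ∑[ r < e ] G (t ℕ.* e ℕ.+ r)     ∎

  ∑<-restrict : ∀ m n (F : ℕ → C) → m ≤ n → (∀ i → m ≤ i → i < n → F i ≈ 0#) → ∑< n F ≈ ∑< m F
  ∑<-restrict m n F m≤n F≈0 = begin
    ∑< n F                                       ≡⟨ ≡.cong (λ k → ∑< k F) (≡.sym (ℕ.m+[n∸m]≡n m≤n)) ⟩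
    ∑< (m ℕ.+ (n ℕ.∸ m)) F                       ≈⟨ ∑<-split m (n ℕ.∸ m) F ⟩
    ∑< m F + ∑[ i < n ℕ.∸ m ] F (m ℕ.+ i)        ≈⟨ +-congˡ (∑<-zeros (n ℕ.∸ m) tail≈0) ⟩
    ∑< m F + 0#                                  ≈⟨ +-identityʳ _ ⟩
    ∑< m F                                       ∎
    where
    tail≈0 : ∀ i → i < n ℕ.∸ m → F (m ℕ.+ i) ≈ 0#
    tail≈0 i i<n∸m = F≈0 (m ℕ.+ i) (ℕ.m≤m+n m i)
      (≡.subst (m ℕ.+ i <_) (ℕ.m+[n∸m]≡n m≤n) (ℕ.+-monoʳ-< m i<n∸m))

  ∑<-single : ∀ n (F : ℕ → C) k → k < n → (∀ i → i < n → i ≢ k → F i ≈ 0#) → ∑< n F ≈ F k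
  ∑<-single (suc n) F k k<1+n F≈0 with k ℕ.≟ n
  ... | yes ≡.refl =
    trans (+-congʳ (∑<-zeros n (λ i i<n → F≈0 i (ℕ.m<n⇒m<1+n i<n) (ℕ.<⇒≢ i<n)))) (+-identityˡ _)
  ... | no k≢n =
    trans (+-cong (∑<-single n F k (ℕ.≤∧≢⇒< (ℕ.≤-pred k<1+n) k≢n) (λ i i<n → F≈0 i (ℕ.m<n⇒m<1+n i<n)))
                  (F≈0 n (ℕ.n<1+n n) (k≢n ∘ ≡.sym)))
          (+-identityʳ _)

  []·-cong : {P Q : Set} (p : Dec P) (q : Dec Q) → (P → Q) → (Q → P) →
             ∀ {v w} → v ≈ w → [ p ]· v ≈ [ q ]· w
  []·-cong (yes _) (yes _) _   _   v≈w = v≈w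
  []·-cong (yes p) (no ¬q) p⇒q _   _   = ⊥-elim (¬q (p⇒q p))
  []·-cong (no ¬p) (yes q) _   q⇒p _   = ⊥-elim (¬p (q⇒p q))
  []·-cong (no _)  (no _)  _   _   _   = refl

  []·-yes : {P : Set} (p : Dec P) → P → ∀ v → [ p ]· v ≈ v
  []·-yes (yes _) _ v = refl
  []·-yes (no ¬p) p v = ⊥-elim (¬p p)

  []·-no : {P : Set} (p : Dec P) → ¬ P → ∀ v → [ p ]· v ≈ 0#
  []·-no (yes p) ¬p v = ⊥-elim (¬p p)
  []·-no (no _)  _  v = refl

  []·-congʳ : {P : Set} (p : Dec P) → ∀ {v w} → (P → v ≈ w) → [ p ]· v ≈ [ p ]· w
  []·-congʳ (yes p) v≈w = v≈w p
  []·-congʳ (no _)  _   = refl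

  []·-0# : {P : Set} (p : Dec P) → [ p ]· 0# ≈ 0#
  []·-0# (yes _) = refl
  []·-0# (no _)  = refl

  []·-*ˡ : {P : Set} (p : Dec P) (a v : C) → a * [ p ]· v ≈ [ p ]· (a * v)
  []·-*ˡ (yes _) a v = refl
  []·-*ˡ (no _)  a v = zeroʳ a

  []·-*ʳ : {P : Set} (p : Dec P) (v a : C) → [ p ]· v * a ≈ [ p ]· (v * a)
  []·-*ʳ (yes _) v a = refl
  []·-*ʳ (no _)  v a = zeroˡ a

  []·-+ : {P : Set} (p : Dec P) (v w : C) → [ p ]· (v + w) ≈ [ p ]· v + [ p ]· w
  []·-+ (yes _) v w = refl
  []·-+ (no _)  v w = sym (+-identityˡ 0#)

  []·-× : {P Q : Set} (p : Dec P) (q : Dec Q) (v : C) → [ p ]· [ q ]· v ≈ [ p ×-dec q ]· v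
  []·-× (yes _) (yes _) v = refl
  []·-× (yes _) (no _)  v = refl
  []·-× (no _)  q       v = refl

  []·-comm : {P Q : Set} (p : Dec P) (q : Dec Q) (v : C) → [ p ]· [ q ]· v ≈ [ q ]· [ p ]· v
  []·-comm (yes _) (yes _) v = refl
  []·-comm (yes _) (no _)  v = refl
  []·-comm (no _)  (yes _) v = refl
  []·-comm (no _)  (no _)  v = refl

  []·-⊎ : {A B D : Set} (a : Dec A) (b : Dec B) (d : Dec D) →
          (A → B ⊎ D) → (B → A) → (D → A) → (B → ¬ D) → ∀ v → [ a ]· v ≈ [ b ]· v + [ d ]· v
  []·-⊎ (yes _) (yes b) (yes d) _   _   _   b⇒¬d v = ⊥-elim (b⇒¬d b d)
  []·-⊎ (yes _) (yes _) (no _)  _   _   _   _    v = sym (+-identityʳ v)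
  []·-⊎ (yes _) (no _)  (yes _) _   _   _   _    v = sym (+-identityˡ v)
  []·-⊎ (yes a) (no ¬b) (no ¬d) a⇒  _   _   _    v = ⊥-elim ([ ¬b , ¬d ] (a⇒ a))
  []·-⊎ (no ¬a) (yes b) _       _   b⇒a _   _    v = ⊥-elim (¬a (b⇒a b))
  []·-⊎ (no ¬a) (no _)  (yes d) _   _   d⇒a _    v = ⊥-elim (¬a (d⇒a d))
  []·-⊎ (no _)  (no _)  (no _)  _   _   _   _    v = sym (+-identityˡ 0#)

  []·-∑< : {P : Set} (p : Dec P) (n : ℕ) (F : ℕ → C) → [ p ]· ∑< n F ≈ ∑[ i < n ] ([ p ]· F i)
  []·-∑< (yes _) n F = refl
  []·-∑< (no _)  n F = sym (∑<-zeros n (λ _ _ → refl))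

  []·-complement : {P : Set} (p : Dec P) (v : C) → v ≈ [ ¬? p ]· v + [ p ]· v
  []·-complement (yes _) v = sym (+-identityˡ v)
  []·-complement (no _)  v = sym (+-identityʳ v)

  ∑<-multiples : ∀ p N (H : ℕ → C) → .{{_ : NonZero p}} →
                 ∑[ d < p ℕ.* N ] ([ p ∣? d ]· H d) ≈ ∑[ j < N ] H (p ℕ.* j)
  ∑<-multiples p zero    H = reflexive (≡.cong (λ k → ∑< k G) (ℕ.*-zeroʳ p))
    where G = λ d → [ p ∣? d ]· H d
  ∑<-multiples p (suc N) H = begin
    ∑< (p ℕ.* suc N) G
      ≡⟨ ≡.cong (λ k → ∑< k G) (≡.trans (ℕ.*-suc p N) (ℕ.+-comm p (p ℕ.* N))) ⟩
    ∑< (p ℕ.* N ℕ.+ p) G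
      ≈⟨ ∑<-split (p ℕ.* N) p G ⟩
    ∑< (p ℕ.* N) G + ∑[ r < p ] G (p ℕ.* N ℕ.+ r)
      ≈⟨ +-cong (∑<-multiples p N H) lastBlock ⟩
    ∑[ j < suc N ] H (p ℕ.* j) ∎
    where
    G = λ d → [ p ∣? d ]· H d
    offMultiple : ∀ r → r < p → r ≢ 0 → G (p ℕ.* N ℕ.+ r) ≈ 0#
    offMultiple r r<p r≢0 = []·-no (p ∣? p ℕ.* N ℕ.+ r)
      (λ p∣pN+r → r≢0 (m∣n<m⇒n≡0 (∣m+n∣m⇒∣n p∣pN+r (m∣m*n N)) r<p)) (H (p ℕ.* N ℕ.+ r))
    lastBlock : ∑[ r < p ] G (p ℕ.* N ℕ.+ r) ≈ H (p ℕ.* N)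
    lastBlock = begin
      ∑[ r < p ] G (p ℕ.* N ℕ.+ r)  ≈⟨ ∑<-single p _ 0 (ℕ.>-nonZero⁻¹ p) offMultiple ⟩
      G (p ℕ.* N ℕ.+ 0)             ≡⟨ ≡.cong G (ℕ.+-identityʳ (p ℕ.* N)) ⟩
      G (p ℕ.* N)                   ≈⟨ []·-yes (p ∣? p ℕ.* N) (m∣m*n N) _ ⟩
      H (p ℕ.* N)                   ∎

  listSum-filter : {A : Set} {P : A → Set} (P? : ∀ x → Dec (P x)) (xs : List A) (F : A → C) →
                   listSum (filter P? xs) F ≈ listSum xs (λ x → [ P? x ]· F x)
  listSum-filter P? []       F = refl
  listSum-filter P? (x ∷ xs) F with P? x
  ... | yes _ = +-congˡ (listSum-filter P? xs F)
  ... | no _  = trans (listSum-filter P? xs F) (sym (+-identityˡ _))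

  listSum-map : {A B : Set} (g : A → B) (xs : List A) (F : B → C) →
                listSum (map g xs) F ≈ listSum xs (F ∘ g)
  listSum-map g []       F = refl
  listSum-map g (x ∷ xs) F = +-congˡ (listSum-map g xs F)

  listSum-applyUpTo : ∀ n (g : ℕ → ℕ) (F : ℕ → C) → listSum (applyUpTo g n) F ≈ ∑< n (F ∘ g)
  listSum-applyUpTo zero    g F = refl
  listSum-applyUpTo (suc n) g F =
    trans (+-congˡ (listSum-applyUpTo n (g ∘ suc) F)) (sym (∑<-shift n (F ∘ g)))

  listSum-range1 : ∀ n (F : ℕ → C) → listSum (range1 n) F ≈ ∑[ i < n ] F (suc i)
  listSum-range1 n F = trans (listSum-map suc (upTo n) F) (listSum-applyUpTo n (λ i → i) (F ∘ suc))

  ∑∣ : ℕ → (ℕ → C) → C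
  ∑∣ m G = ∑[ d < suc m ] ([ d ∣? m ]· G d)

  syntax ∑∣ m (λ d → G) = ∑[ d ∣ m ] G

  ∑∣-extend : ∀ m N (G : ℕ → C) → .{{_ : NonZero m}} → suc m ≤ N →
              ∑[ d < N ] ([ d ∣? m ]· G d) ≈ ∑∣ m G
  ∑∣-extend m N G m<N = ∑<-restrict (suc m) N _ m<N
    (λ d m<d _ → []·-no (d ∣? m) (λ d∣m → ℕ.<⇒≱ m<d (∣⇒≤ d∣m)) (G d))

  listSum-divisors : ∀ m (G : ℕ → C) → .{{_ : NonZero m}} → listSum (divisors m) G ≈ ∑∣ m G
  listSum-divisors m G = begin
    listSum (divisors m) G
      ≈⟨ listSum-filter (_∣? m) (range1 m) G ⟩
    listSum (range1 m) (λ d → [ d ∣? m ]· G d)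
      ≈⟨ listSum-range1 m _ ⟩
    ∑[ i < m ] ([ suc i ∣? m ]· G (suc i))
      ≈⟨ +-identityˡ _ ⟨
    0# + ∑[ i < m ] ([ suc i ∣? m ]· G (suc i))
      ≈⟨ +-congʳ ([]·-no (0 ∣? m) (ℕ.≢-nonZero⁻¹ m ∘ 0∣⇒≡0) (G 0)) ⟨
    [ 0 ∣? m ]· G 0 + ∑[ i < m ] ([ suc i ∣? m ]· G (suc i))
      ≈⟨ ∑<-shift m _ ⟨
    ∑∣ m G ∎

  ∑∣-cong : ∀ m {G G′ : ℕ → C} → (∀ d → d ∣ m → G d ≈ G′ d) → ∑∣ m G ≈ ∑∣ m G′
  ∑∣-cong m G≈G′ = ∑<-cong (suc m) (λ d _ → []·-congʳ (d ∣? m) (G≈G′ d))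

  ∑∣-*ˡ : ∀ m a (G : ℕ → C) → ∑[ d ∣ m ] (a * G d) ≈ a * ∑∣ m G
  ∑∣-*ˡ m a G = trans (∑<-cong (suc m) (λ d _ → sym ([]·-*ˡ (d ∣? m) a (G d)))) (∑<-*ˡ (suc m) a _)

  ∑∣-*ʳ : ∀ m a (G : ℕ → C) → ∑[ d ∣ m ] (G d * a) ≈ ∑∣ m G * a
  ∑∣-*ʳ m a G = trans (∑<-cong (suc m) (λ d _ → sym ([]·-*ʳ (d ∣? m) (G d) a))) (∑<-*ʳ (suc m) a _)

  ∑∣-∑<-swap : ∀ m N (H : ℕ → ℕ → C) → ∑[ d ∣ m ] ∑[ k < N ] H d k ≈ ∑[ k < N ] ∑[ d ∣ m ] H d k
  ∑∣-∑<-swap m N H = trans (∑<-cong (suc m) (λ d _ → []·-∑< (d ∣? m) N (H d))) (∑<-swap (suc m) N _)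

  ∑∣-multiples-∣ : ∀ m k (G : ℕ → C) → .{{_ : NonZero m}} → k ∣ m →
                   ∑[ e ∣ m ] ([ k ∣? e ]· G e) ≈ ∑[ j ∣ divℕ m k ] G (k ℕ.* j)
  ∑∣-multiples-∣ m k G k∣m = begin
    ∑[ e ∣ m ] ([ k ∣? e ]· G e)
      ≈⟨ ∑<-cong (suc m) (λ e _ → []·-comm (e ∣? m) (k ∣? e) (G e)) ⟩
    ∑[ e < suc m ] ([ k ∣? e ]· [ e ∣? m ]· G e)
      ≈⟨ ∑<-restrict (suc m) (k ℕ.* suc q) _ m<k[q+1] beyondM ⟨
    ∑[ e < k ℕ.* suc q ] ([ k ∣? e ]· [ e ∣? m ]· G e)
      ≈⟨ ∑<-multiples k (suc q) (λ e → [ e ∣? m ]· G e) ⟩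
    ∑[ j < suc q ] ([ k ℕ.* j ∣? m ]· G (k ℕ.* j))
      ≈⟨ ∑<-cong (suc q) (λ j _ → []·-cong (k ℕ.* j ∣? m) (j ∣? q) (kj∣m⇒j∣q j) (j∣q⇒kj∣m j) refl) ⟩
    ∑[ j ∣ q ] G (k ℕ.* j) ∎
    where
    q = divℕ m k
    instance _ = ∣⇒nonZero k∣m
    kq≡m : k ℕ.* q ≡ m
    kq≡m = *-divℕ k∣m
    m<k[q+1] : suc m ≤ k ℕ.* suc q
    m<k[q+1] = ≡.subst₂ _≤_ (≡.cong suc kq≡m) (≡.sym (ℕ.*-suc k q))
                        (ℕ.+-monoˡ-≤ (k ℕ.* q) (ℕ.>-nonZero⁻¹ k))
    beyondM : ∀ e → suc m ≤ e → e < k ℕ.* suc q → [ k ∣? e ]· [ e ∣? m ]· G e ≈ 0#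
    beyondM e m<e _ =
      trans ([]·-congʳ (k ∣? e) (λ _ → []·-no (e ∣? m) (λ e∣m → ℕ.<⇒≱ m<e (∣⇒≤ e∣m)) (G e)))
            ([]·-0# (k ∣? e))
    kj∣m⇒j∣q : ∀ j → k ℕ.* j ∣ m → j ∣ q
    kj∣m⇒j∣q j kj∣m = *-cancelˡ-∣ k (≡.subst (k ℕ.* j ∣_) (≡.sym kq≡m) kj∣m)
    j∣q⇒kj∣m : ∀ j → j ∣ q → k ℕ.* j ∣ m
    j∣q⇒kj∣m j j∣q = ≡.subst (k ℕ.* j ∣_) kq≡m (*-monoʳ-∣ k j∣q)

  ∑∣-prime∤ : ∀ m p (G : ℕ → C) → .{{_ : NonZero m}} → Prime p → p ∣ m →
              ∑[ d ∣ m ] ([ ¬? (p ∣? d) ]· G d) ≈ ∑[ d ∣ divℕ m p ] ([ ¬? (p ∣? d) ]· G d)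
  ∑∣-prime∤ m p G p-prime p∣m = begin
    ∑[ d < suc m ] ([ d ∣? m ]· [ ¬? (p ∣? d) ]· G d)     ≈⟨ ∑<-cong (suc m) (λ d _ → divides-m⇔m′ d) ⟩
    ∑[ d < suc m ] ([ d ∣? m′ ]· [ ¬? (p ∣? d) ]· G d)    ≈⟨ ∑∣-extend m′ (suc m) _ ⦃ divℕ-nonZero p∣m ⦄ (s≤s (divℕ-≤ m p)) ⟩
    ∑[ d ∣ m′ ] ([ ¬? (p ∣? d) ]· G d)                    ∎
    where
    m′ = divℕ m p
    pm′≡m : p ℕ.* m′ ≡ m
    pm′≡m = *-divℕ p∣m
    to : ∀ {d} → (d ∣ m) × ¬ p ∣ d → (d ∣ m′) × ¬ p ∣ d
    to {d} (d∣m , p∤d) = coprime-divisor (prime∤⇒coprime p-prime p∤d) (≡.subst (d ∣_) (≡.sym pm′≡m) d∣m) , p∤d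
    from : ∀ {d} → (d ∣ m′) × ¬ p ∣ d → (d ∣ m) × ¬ p ∣ d
    from {d} (d∣m′ , p∤d) = ≡.subst (d ∣_) pm′≡m (∣n⇒∣m*n p d∣m′) , p∤d
    divides-m⇔m′ : ∀ d → [ d ∣? m ]· [ ¬? (p ∣? d) ]· G d ≈ [ d ∣? m′ ]· [ ¬? (p ∣? d) ]· G d
    divides-m⇔m′ d = begin
      [ d ∣? m ]· [ ¬? (p ∣? d) ]· G d         ≈⟨ []·-× (d ∣? m) (¬? (p ∣? d)) (G d) ⟩
      [ (d ∣? m) ×-dec ¬? (p ∣? d) ]· G d      ≈⟨ []·-cong ((d ∣? m) ×-dec _) ((d ∣? m′) ×-dec _) to from refl ⟩
      [ (d ∣? m′) ×-dec ¬? (p ∣? d) ]· G d     ≈⟨ []·-× (d ∣? m′) (¬? (p ∣? d)) (G d) ⟨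
      [ d ∣? m′ ]· [ ¬? (p ∣? d) ]· G d        ∎

  ∑∣-multiples : ∀ m k (G : ℕ → C) → .{{_ : NonZero m}} →
                 ∑[ e ∣ m ] ([ k ∣? e ]· G e) ≈ [ k ∣? m ]· ∑[ j ∣ divℕ m k ] G (k ℕ.* j)
  ∑∣-multiples m k G = onDecision (k ∣? m)
    where
    onDecision : (k∣?m : Dec (k ∣ m)) →
                 ∑[ e ∣ m ] ([ k ∣? e ]· G e) ≈ [ k∣?m ]· ∑[ j ∣ divℕ m k ] G (k ℕ.* j)
    onDecision (no  k∤m) = ∑<-zeros (suc m) (λ e _ →
      trans ([]·-congʳ (e ∣? m) (λ e∣m → []·-no (k ∣? e) (k∤m ∘ flip ∣-trans e∣m) (G e)))
            ([]·-0# (e ∣? m)))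
    onDecision (yes k∣m) = ∑∣-multiples-∣ m k G k∣m

  ∑∣∑∣-expand : ∀ m (H : ℕ → ℕ → C) → .{{_ : NonZero m}} →
                ∑[ k ∣ m ] ∑[ j ∣ divℕ m k ] H k j
                ≈ ∑[ k < suc m ] ∑[ j < suc m ] ([ (k ∣? m) ×-dec (j ∣? divℕ m k) ]· H k j)
  ∑∣∑∣-expand m H = ∑<-cong (suc m) (λ k _ → begin
    [ k ∣? m ]· ∑[ j ∣ divℕ m k ] H k j
      ≈⟨ []·-congʳ (k ∣? m) (λ k∣m → sym (extend k∣m)) ⟩
    [ k ∣? m ]· ∑[ j < suc m ] ([ j ∣? divℕ m k ]· H k j)
      ≈⟨ []·-∑< (k ∣? m) (suc m) _ ⟩
    ∑[ j < suc m ] ([ k ∣? m ]· [ j ∣? divℕ m k ]· H k j)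
      ≈⟨ ∑<-cong (suc m) (λ j _ → []·-× (k ∣? m) (j ∣? divℕ m k) (H k j)) ⟩
    ∑[ j < suc m ] ([ (k ∣? m) ×-dec (j ∣? divℕ m k) ]· H k j) ∎)
    where
    extend : ∀ {k} → k ∣ m → ∑[ j < suc m ] ([ j ∣? divℕ m k ]· H k j) ≈ ∑[ j ∣ divℕ m k ] H k j
    extend {k} k∣m = ∑∣-extend (divℕ m k) (suc m) (H k) ⦃ divℕ-nonZero k∣m ⦄ (s≤s (divℕ-≤ m k))

  ∑∣∑∣-swap : ∀ m (H : ℕ → ℕ → C) → .{{_ : NonZero m}} →
              ∑[ k ∣ m ] ∑[ j ∣ divℕ m k ] H k j ≈ ∑[ j ∣ m ] ∑[ k ∣ divℕ m j ] H k j
  ∑∣∑∣-swap m H = begin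
    ∑[ k ∣ m ] ∑[ j ∣ divℕ m k ] H k j
      ≈⟨ ∑∣∑∣-expand m H ⟩
    ∑[ k < suc m ] ∑[ j < suc m ] ([ (k ∣? m) ×-dec (j ∣? divℕ m k) ]· H k j)
      ≈⟨ ∑<-cong (suc m) (λ k _ → ∑<-cong (suc m) (λ j _ → reindex k j)) ⟩
    ∑[ k < suc m ] ∑[ j < suc m ] ([ (j ∣? m) ×-dec (k ∣? divℕ m j) ]· H k j)
      ≈⟨ ∑<-swap (suc m) (suc m) _ ⟩
    ∑[ j < suc m ] ∑[ k < suc m ] ([ (j ∣? m) ×-dec (k ∣? divℕ m j) ]· H k j)
      ≈⟨ ∑∣∑∣-expand m (λ j k → H k j) ⟨
    ∑[ j ∣ m ] ∑[ k ∣ divℕ m j ] H k j ∎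
    where
    reindex : ∀ k j → [ (k ∣? m) ×-dec (j ∣? divℕ m k) ]· H k j ≈ [ (j ∣? m) ×-dec (k ∣? divℕ m j) ]· H k j
    reindex k j = []·-cong ((k ∣? m) ×-dec (j ∣? divℕ m k)) ((j ∣? m) ×-dec (k ∣? divℕ m j))
                           ∣divℕ-swap ∣divℕ-swap refl

  ∑∣-[m/j≡1] : ∀ m (G : ℕ → C) → .{{_ : NonZero m}} → ∑[ j ∣ m ] ([ divℕ m j ≟ 1 ]· G j) ≈ G m
  ∑∣-[m/j≡1] m G = begin
    ∑[ j ∣ m ] ([ divℕ m j ≟ 1 ]· G j)     ≈⟨ ∑<-single (suc m) _ m (ℕ.n<1+n m) notM ⟩
    [ m ∣? m ]· [ divℕ m m ≟ 1 ]· G m      ≈⟨ []·-yes (m ∣? m) ∣-refl _ ⟩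
    [ divℕ m m ≟ 1 ]· G m                  ≈⟨ []·-yes (divℕ m m ≟ 1) (divℕ-self m) (G m) ⟩
    G m                                    ∎
    where
    notM : ∀ j → j < suc m → j ≢ m → [ j ∣? m ]· [ divℕ m j ≟ 1 ]· G j ≈ 0#
    notM j _ j≢m =
      trans ([]·-congʳ (j ∣? m) (λ j∣m → []·-no (divℕ m j ≟ 1) (j≢m ∘ divℕ≡1⇒≡ j∣m) (G j)))
            ([]·-0# (j ∣? m))

module ℕ∑ = FiniteSums ℕ.+-*-commutativeSemiring

module Counting where

  open ℕ∑
  open ≡.≡-Reasoning

  ∑<-ones : ∀ n → ∑[ i < n ] 1 ≡ n
  ∑<-ones zero    = ≡.refl
  ∑<-ones (suc n) = ≡.trans (≡.cong (ℕ._+ 1) (∑<-ones n)) (ℕ.+-comm n 1)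

  length-filter : {A : Set} {P : A → Set} (P? : ∀ x → Dec (P x)) (xs : List A) →
                  length (filter P? xs) ≡ listSum xs (λ x → [ P? x ]· 1)
  length-filter P? []       = ≡.refl
  length-filter P? (x ∷ xs) with P? x
  ... | yes _ = ≡.cong suc (length-filter P? xs)
  ... | no _  = length-filter P? xs

  length-filter-range1 : {P : ℕ → Set} (P? : ∀ x → Dec (P x)) (n : ℕ) →
                         length (filter P? (range1 n)) ≡ ∑[ i < n ] ([ P? (suc i) ]· 1)
  length-filter-range1 P? n = ≡.trans (length-filter P? (range1 n)) (listSum-range1 n _)

  φ≡∑ : ∀ n → φ n ≡ ∑[ x < n ] ([ gcd x n ≟ 1 ]· 1)
  φ≡∑ n = ≡.trans (length-filter-range1 (λ a → gcd a n ≟ 1) n)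
                  (∑<-rotate n (λ x → [ gcd x n ≟ 1 ]· 1) (≡.cong (λ g → [ g ≟ 1 ]· 1) (gcd[n,n]≡gcd[0,n] n)))

  φ-nonZero : ∀ n .{{_ : NonZero n}} → NonZero (φ n)
  φ-nonZero (suc n) = ≡.subst NonZero (≡.sym φ≡1+) _
    where
    unit = λ i → [ gcd (suc i) (suc n) ≟ 1 ]· 1
    φ≡1+ : φ (suc n) ≡ suc (∑[ i < n ] unit (suc i))
    φ≡1+ = ≡.trans (length-filter-range1 (λ a → gcd a (suc n) ≟ 1) (suc n))
           (≡.trans (∑<-shift n unit)
                    (≡.cong (ℕ._+ ∑[ i < n ] unit (suc i)) ([]·-yes (gcd 1 (suc n) ≟ 1) (gcd-zeroˡ (suc n)) 1)))

  NP≡∑ : ∀ P e → NP P e ≡ ∑[ x < e ] ([ (e ∣? ∣ evalPoly P (+ x) ∣) ×-dec (gcd x e ≟ 1) ]· 1)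
  NP≡∑ P e = ≡.trans (length-filter _ (upTo e)) (listSum-applyUpTo e (λ x → x) _)

  ∑-linearRoots≡1 : ∀ {p e} x → Prime p → ¬ p ∣ e → ∑[ t < p ] ([ p ∣? t ℕ.* e ℕ.+ x ]· 1) ≡ 1
  ∑-linearRoots≡1 {p} {e} x p-prime p∤e =
    ≡.trans (∑<-single p _ t₀ (m%n<n t p) notRoot) ([]·-yes (p ∣? _) p∣t₀e+x 1)
    where
    instance _ = prime⇒nonZero p-prime
    t = proj₁ (linearCongruence-solvable x p-prime p∤e)
    t₀ = t % p
    p∣t₀e+x : p ∣ t₀ ℕ.* e ℕ.+ x
    p∣t₀e+x = ∣m+n∣m⇒∣n (≡.subst (p ∣_) te+x≡ (proj₂ (linearCongruence-solvable x p-prime p∤e)))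
                        (∣m⇒∣m*n e (n∣m*n (t / p)))
      where
      split : ∀ r q p e x → (r ℕ.+ q ℕ.* p) ℕ.* e ℕ.+ x ≡ q ℕ.* p ℕ.* e ℕ.+ (r ℕ.* e ℕ.+ x)
      split = ℕ-Solver.solve-∀
      te+x≡ : t ℕ.* e ℕ.+ x ≡ t / p ℕ.* p ℕ.* e ℕ.+ (t₀ ℕ.* e ℕ.+ x)
      te+x≡ = ≡.trans (≡.cong (λ s → s ℕ.* e ℕ.+ x) (m≡m%n+[m/n]*n t p)) (split t₀ (t / p) p e x)
    p⊥e = Coprime.sym (prime∤⇒coprime p-prime p∤e)
    notRoot : ∀ i → i < p → i ≢ t₀ → [ p ∣? i ℕ.* e ℕ.+ x ]· 1 ≡ 0
    notRoot i i<p i≢t₀ = []·-no (p ∣? _) isNotRoot 1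
      where
      isNotRoot : ¬ p ∣ i ℕ.* e ℕ.+ x
      isNotRoot p∣ie+x with ℕ.≤-total i t₀
      ... | inj₁ i≤t₀ = i≢t₀ (linearCongruence-unique p⊥e i≤t₀ (m%n<n t p) p∣ie+x p∣t₀e+x)
      ... | inj₂ t₀≤i = i≢t₀ (≡.sym (linearCongruence-unique p⊥e t₀≤i i<p p∣t₀e+x p∣ie+x))

  ∑-unitLifts : ∀ e p x → Prime p →
                ∑[ t < p ] ([ gcd (t ℕ.* e ℕ.+ x) (e ℕ.* p) ≟ 1 ]· 1)
                ≡ [ gcd x e ≟ 1 ]· (p ℕ.∸ [ ¬? (p ∣? e) ]· 1)
  ∑-unitLifts e p x p-prime = lifts (gcd x e ≟ 1) (p ∣? e)
    where
    y : ℕ → ℕ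
    y t = t ℕ.* e ℕ.+ x
    unit? : ∀ t → Dec (gcd (y t) (e ℕ.* p) ≡ 1)
    unit? t = gcd (y t) (e ℕ.* p) ≟ 1
    root? : ∀ t → Dec (p ∣ y t)
    root? t = p ∣? y t
    unit⇒x⊥e : ∀ t → gcd (y t) (e ℕ.* p) ≡ 1 → gcd x e ≡ 1
    unit⇒x⊥e t y⊥ep = coprime⇒gcd≡1 (Equivalence.from (coprime-+* t e x)
                        (coprime-∣ʳ (gcd≡1⇒coprime y⊥ep) (m∣m*n p)))
    y⊥e : gcd x e ≡ 1 → ∀ t → Coprime (y t) e
    y⊥e x⊥e t = Equivalence.to (coprime-+* t e x) (gcd≡1⇒coprime x⊥e)
    lifts : (x⊥e? : Dec (gcd x e ≡ 1)) (p∣?e : Dec (p ∣ e)) →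
            ∑[ t < p ] ([ unit? t ]· 1) ≡ [ x⊥e? ]· (p ℕ.∸ [ ¬? p∣?e ]· 1)
    lifts (no ¬x⊥e) _         = ∑<-zeros p (λ t _ → []·-no (unit? t) (¬x⊥e ∘ unit⇒x⊥e t) 1)
    lifts (yes x⊥e) (yes p∣e) = ≡.trans (∑<-cong p (λ t _ → []·-yes (unit? t) (unit t) 1)) (∑<-ones p)
      where
      unit : ∀ t → gcd (y t) (e ℕ.* p) ≡ 1
      unit t = coprime⇒gcd≡1 (coprime-*ʳ (y⊥e x⊥e t) (coprime-∣ʳ (y⊥e x⊥e t) p∣e))
    lifts (yes x⊥e) (no  p∤e) = begin
      ∑[ t < p ] ([ unit? t ]· 1)
        ≡⟨ ∑<-cong p (λ t _ → []·-cong (unit? t) (¬? (root? t)) (nonRoot t) (unit t) ≡.refl) ⟩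
      ∑[ t < p ] ([ ¬? (root? t) ]· 1)
        ≡⟨ ℕ.m+n∸n≡m _ 1 ⟨
      ∑[ t < p ] ([ ¬? (root? t) ]· 1) ℕ.+ 1 ℕ.∸ 1
        ≡⟨ ≡.cong (ℕ._∸ 1) nonRoots+1≡p ⟩
      p ℕ.∸ 1 ∎
      where
      nonRoot : ∀ t → gcd (y t) (e ℕ.* p) ≡ 1 → ¬ p ∣ y t
      nonRoot t y⊥ep = coprime⇒prime∤ p-prime (coprime-∣ʳ (gcd≡1⇒coprime y⊥ep) (n∣m*n e))
      unit : ∀ t → ¬ p ∣ y t → gcd (y t) (e ℕ.* p) ≡ 1
      unit t p∤y = coprime⇒gcd≡1 (coprime-*ʳ (y⊥e x⊥e t) (prime∤⇒coprime p-prime p∤y))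
      nonRoots = ∑[ t < p ] ([ ¬? (root? t) ]· 1)
      nonRoots+1≡p : nonRoots ℕ.+ 1 ≡ p
      nonRoots+1≡p = begin
        ∑[ t < p ] ([ ¬? (root? t) ]· 1) ℕ.+ 1
          ≡⟨ ≡.cong (nonRoots ℕ.+_) (∑-linearRoots≡1 x p-prime p∤e) ⟨
        ∑[ t < p ] ([ ¬? (root? t) ]· 1) ℕ.+ ∑[ t < p ] ([ root? t ]· 1)
          ≡⟨ ∑<-+ p _ _ ⟨
        ∑[ t < p ] ([ ¬? (root? t) ]· 1 ℕ.+ [ root? t ]· 1)
          ≡⟨ ∑<-cong p (λ t _ → ≡.sym ([]·-complement (root? t) 1)) ⟩
        ∑[ t < p ] 1
          ≡⟨ ∑<-ones p ⟩
        p ∎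

  fiberCount : ℕ → (e : ℕ) → .{{NonZero e}} → ℕ → ℕ
  fiberCount n e x = ∑[ a < n ] ([ gcd a n ≟ 1 ]· [ a % e ≟ x ]· 1)

  ∑-byResidue : ∀ n e .{{_ : NonZero e}} (W : ℕ → ℕ) →
                ∑[ a < n ] ([ gcd a n ≟ 1 ]· W (a % e)) ≡ ∑[ x < e ] (W x ℕ.* fiberCount n e x)
  ∑-byResidue n e W = begin
    ∑[ a < n ] ([ gcd a n ≟ 1 ]· W (a % e))
      ≡⟨ ∑<-cong n (λ a _ → ≡.cong ([ gcd a n ≟ 1 ]·_) (expand a)) ⟩
    ∑[ a < n ] ([ gcd a n ≟ 1 ]· ∑[ x < e ] ([ a % e ≟ x ]· W x))
      ≡⟨ ∑<-cong n (λ a _ → []·-∑< (gcd a n ≟ 1) e _) ⟩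
    ∑[ a < n ] ∑[ x < e ] ([ gcd a n ≟ 1 ]· [ a % e ≟ x ]· W x)
      ≡⟨ ∑<-swap n e _ ⟩
    ∑[ x < e ] ∑[ a < n ] ([ gcd a n ≟ 1 ]· [ a % e ≟ x ]· W x)
      ≡⟨ ∑<-cong e (λ x _ → ∑<-cong n (λ a _ → pull a x)) ⟩
    ∑[ x < e ] ∑[ a < n ] (W x ℕ.* [ gcd a n ≟ 1 ]· [ a % e ≟ x ]· 1)
      ≡⟨ ∑<-cong e (λ x _ → ∑<-*ˡ n (W x) _) ⟩
    ∑[ x < e ] (W x ℕ.* fiberCount n e x) ∎
    where
    expand : ∀ a → W (a % e) ≡ ∑[ x < e ] ([ a % e ≟ x ]· W x)
    expand a = ≡.sym (≡.trans (∑<-single e _ (a % e) (m%n<n a e) (λ x _ x≢ → []·-no (a % e ≟ x) (x≢ ∘ ≡.sym) _))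
                              ([]·-yes (a % e ≟ a % e) ≡.refl _))
    pull : ∀ a x → [ gcd a n ≟ 1 ]· [ a % e ≟ x ]· W x ≡ W x ℕ.* [ gcd a n ≟ 1 ]· [ a % e ≟ x ]· 1
    pull a x with gcd a n ≟ 1 | a % e ≟ x
    ... | yes _ | yes _ = ≡.sym (ℕ.*-identityʳ (W x))
    ... | yes _ | no _  = ≡.sym (ℕ.*-zeroʳ (W x))
    ... | no _  | _     = ≡.sym (ℕ.*-zeroʳ (W x))

  fiberCount-self : ∀ {n e} .{{_ : NonZero e}} → e ≡ n → ∀ x → x < e → fiberCount n e x ≡ [ gcd x e ≟ 1 ]· 1
  fiberCount-self {n} ≡.refl x x<n =
    ≡.trans (∑<-single n _ x x<n otherResidue)
            (≡.cong ([ gcd x n ≟ 1 ]·_) ([]·-yes (x % n ≟ x) (m<n⇒m%n≡m x<n) 1))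
    where
    otherResidue : ∀ a → a < n → a ≢ x → [ gcd a n ≟ 1 ]· [ a % n ≟ x ]· 1 ≡ 0
    otherResidue a a<n a≢x =
      ≡.trans (≡.cong ([ gcd a n ≟ 1 ]·_) ([]·-no (a % n ≟ x) (a≢x ∘ ≡.trans (≡.sym (m<n⇒m%n≡m a<n))) 1))
              ([]·-0# (gcd a n ≟ 1))

  fiberCount-refine : ∀ {n e p} K → Prime p → .{{_ : NonZero e}} .{{_ : NonZero (e ℕ.* p)}} →
    (∀ y → y < e ℕ.* p → fiberCount n (e ℕ.* p) y ≡ [ gcd y (e ℕ.* p) ≟ 1 ]· K) →
    ∀ x → x < e → fiberCount n e x ≡ [ gcd x e ≟ 1 ]· ((p ℕ.∸ [ ¬? (p ∣? e) ]· 1) ℕ.* K)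
  fiberCount-refine {n} {e} {p} K p-prime fine x x<e = begin
    fiberCount n e x
      ≡⟨ ∑<-cong n (λ a _ → ≡.cong (λ r → [ gcd a n ≟ 1 ]· [ r ≟ x ]· 1) (≡.sym (mod-ep-e a))) ⟩
    ∑[ a < n ] ([ gcd a n ≟ 1 ]· W (a % ep))
      ≡⟨ ∑-byResidue n ep W ⟩
    ∑[ y < ep ] (W y ℕ.* fiberCount n ep y)
      ≡⟨ ∑<-cong ep (λ y y<ep → ≡.trans (≡.cong (W y ℕ.*_) (fine y y<ep)) (reorder (y % e ≟ x) (gcd y ep ≟ 1))) ⟩
    ∑[ y < ep ] (G y ℕ.* K)
      ≡⟨ ∑<-*ʳ ep K G ⟩
    ∑< ep G ℕ.* K
      ≡⟨ ≡.cong (ℕ._* K) lifts ⟩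
    [ gcd x e ≟ 1 ]· (p ℕ.∸ [ ¬? (p ∣? e) ]· 1) ℕ.* K
      ≡⟨ []·-*ʳ (gcd x e ≟ 1) _ K ⟩
    [ gcd x e ≟ 1 ]· ((p ℕ.∸ [ ¬? (p ∣? e) ]· 1) ℕ.* K) ∎
    where
    ep = e ℕ.* p
    W G : ℕ → ℕ
    W y = [ y % e ≟ x ]· 1
    G y = [ y % e ≟ x ]· [ gcd y ep ≟ 1 ]· 1
    mod-ep-e : ∀ a → a % ep % e ≡ a % e
    mod-ep-e a = m∣n⇒o%n%m≡o%m e ep a (m∣m*n p)
    reorder : ∀ {P Q} (r : Dec P) (u : Dec Q) → [ r ]· 1 ℕ.* [ u ]· K ≡ [ r ]· [ u ]· 1 ℕ.* K
    reorder (yes _) (yes _) = ≡.refl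
    reorder (yes _) (no _)  = ≡.refl
    reorder (no _)  _       = ≡.refl
    lifts : ∑< ep G ≡ [ gcd x e ≟ 1 ]· (p ℕ.∸ [ ¬? (p ∣? e) ]· 1)
    lifts = begin
      ∑< ep G
        ≡⟨ ≡.cong (λ m → ∑< m G) (ℕ.*-comm e p) ⟩
      ∑< (p ℕ.* e) G
        ≡⟨ ∑<-blocks p e G ⟩
      ∑[ t < p ] ∑[ r < e ] G (t ℕ.* e ℕ.+ r)
        ≡⟨ ∑<-cong p (λ t _ → ≡.trans (∑<-single e _ x x<e (otherResidue t)) (onResidue t)) ⟩
      ∑[ t < p ] ([ gcd (t ℕ.* e ℕ.+ x) ep ≟ 1 ]· 1)
        ≡⟨ ∑-unitLifts e p x p-prime ⟩
      [ gcd x e ≟ 1 ]· (p ℕ.∸ [ ¬? (p ∣? e) ]· 1) ∎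
      where
      otherResidue : ∀ t r → r < e → r ≢ x → G (t ℕ.* e ℕ.+ r) ≡ 0
      otherResidue t r r<e r≢x = []·-no ((t ℕ.* e ℕ.+ r) % e ≟ x) (r≢x ∘ ≡.trans (≡.sym ([te+r]%e≡r t e r r<e))) _
      onResidue : ∀ t → G (t ℕ.* e ℕ.+ x) ≡ [ gcd (t ℕ.* e ℕ.+ x) ep ≟ 1 ]· 1
      onResidue t = []·-yes ((t ℕ.* e ℕ.+ x) % e ≟ x) ([te+r]%e≡r t e x x<e) _

  fiberCount-uniform : ∀ n e .{{_ : NonZero n}} .{{_ : NonZero e}} → e ∣ n →
                       ∃[ K ] ∀ x → x < e → fiberCount n e x ≡ [ gcd x e ≟ 1 ]· K
  fiberCount-uniform n e e∣n@(divides q n≡qe) = refineAlong (factors factorisation) e primes n≡e∏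
    where
    instance _ = quotient≢0 e∣n
    factorisation = factorise q
    primes = PrimeFactorisation.factorsPrime factorisation
    n≡e∏ : n ≡ e ℕ.* product (factors factorisation)
    n≡e∏ = ≡.trans n≡qe (≡.trans (≡.cong (ℕ._* e) (PrimeFactorisation.isFactorisation factorisation)) (ℕ.*-comm _ e))
    refineAlong : ∀ ps m .{{_ : NonZero m}} → All Prime ps → n ≡ m ℕ.* product ps →
                  ∃[ K ] ∀ x → x < m → fiberCount n m x ≡ [ gcd x m ≟ 1 ]· K
    refineAlong []       m _ n≡m*1 = 1 , fiberCount-self (≡.sym (≡.trans n≡m*1 (ℕ.*-identityʳ m)))
    refineAlong (p ∷ ps) m (p-prime ∷ ps-prime) n≡ =
      _ , fiberCount-refine {n} K′ p-prime (proj₂ coarse)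
      where
      instance
        _ = prime⇒nonZero p-prime
        _ = ℕ.m*n≢0 m p
      coarse = refineAlong ps (m ℕ.* p) ps-prime (≡.trans n≡ (≡.sym (ℕ.*-assoc m p (product ps))))
      K′ = proj₁ coarse

  ∑-uniformFibers : ∀ n e K .{{_ : NonZero e}} → (∀ x → x < e → fiberCount n e x ≡ [ gcd x e ≟ 1 ]· K) →
                    ∀ W → ∑[ a < n ] ([ gcd a n ≟ 1 ]· W (a % e)) ≡ ∑[ x < e ] ([ gcd x e ≟ 1 ]· W x) ℕ.* K
  ∑-uniformFibers n e K uniform W = begin
    ∑[ a < n ] ([ gcd a n ≟ 1 ]· W (a % e))
      ≡⟨ ∑-byResidue n e W ⟩
    ∑[ x < e ] (W x ℕ.* fiberCount n e x)
      ≡⟨ ∑<-cong e (λ x x<e → ≡.trans (≡.cong (W x ℕ.*_) (uniform x x<e)) (reorder x)) ⟩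
    ∑[ x < e ] ([ gcd x e ≟ 1 ]· W x ℕ.* K)
      ≡⟨ ∑<-*ʳ e K _ ⟩
    ∑[ x < e ] ([ gcd x e ≟ 1 ]· W x) ℕ.* K ∎
    where
    reorder : ∀ x → W x ℕ.* [ gcd x e ≟ 1 ]· K ≡ [ gcd x e ≟ 1 ]· W x ℕ.* K
    reorder x with gcd x e ≟ 1
    ... | yes _ = ≡.refl
    ... | no _  = ℕ.*-zeroʳ (W x)

  φ-uniformFibers : ∀ n e K .{{_ : NonZero e}} → (∀ x → x < e → fiberCount n e x ≡ [ gcd x e ≟ 1 ]· K) →
                    φ n ≡ φ e ℕ.* K
  φ-uniformFibers n e K uniform = begin
    φ n                                       ≡⟨ φ≡∑ n ⟩
    ∑[ a < n ] ([ gcd a n ≟ 1 ]· 1)           ≡⟨ ∑-uniformFibers n e K uniform (λ _ → 1) ⟩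
    ∑[ x < e ] ([ gcd x e ≟ 1 ]· 1) ℕ.* K     ≡⟨ ≡.cong (ℕ._* K) (≡.sym (φ≡∑ e)) ⟩
    φ e ℕ.* K                                 ∎

  coprimeRootCount : ∀ n e P .{{_ : NonZero n}} → e ∣ n →
    ∑[ i < n ] ([ gcd (suc i) n ≟ 1 ]· [ e ∣? ∣ evalPoly P (+ suc i) ∣ ]· 1) ≡ divℕ (φ n) (φ e) ℕ.* NP P e
  coprimeRootCount n e P e∣n = begin
    ∑[ i < n ] Root (suc i)
      ≡⟨ ∑<-rotate n Root Root[n]≡Root[0] ⟩
    ∑< n Root
      ≡⟨ ∑<-cong n (λ a _ → ≡.cong ([ gcd a n ≟ 1 ]·_) (rootByResidue a)) ⟩
    ∑[ a < n ] ([ gcd a n ≟ 1 ]· W (a % e))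
      ≡⟨ ∑-uniformFibers n e K e-uniform W ⟩
    ∑[ x < e ] ([ gcd x e ≟ 1 ]· W x) ℕ.* K
      ≡⟨ ≡.cong (ℕ._* K) (≡.trans (∑<-cong e (λ x _ → coprimeRoot x)) (≡.sym (NP≡∑ P e))) ⟩
    NP P e ℕ.* K
      ≡⟨ ℕ.*-comm (NP P e) K ⟩
    K ℕ.* NP P e
      ≡⟨ ≡.cong (ℕ._* NP P e) (≡.sym φn/φe≡K) ⟩
    divℕ (φ n) (φ e) ℕ.* NP P e ∎
    where
    instance
      _ = ∣⇒nonZero e∣n
      _ = φ-nonZero e
    K = proj₁ (fiberCount-uniform n e e∣n)
    e-uniform = proj₂ (fiberCount-uniform n e e∣n)
    W : ℕ → ℕ
    W x = [ e ∣? ∣ evalPoly P (+ x) ∣ ]· 1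
    Root : ℕ → ℕ
    Root a = [ gcd a n ≟ 1 ]· W a
    W-mod : ∀ {a b} k → a ≡ b ℕ.+ k ℕ.* e → W a ≡ W b
    W-mod k a≡ = []·-cong (e ∣? _) (e ∣? _) (Equivalence.to eqv) (Equivalence.from eqv) ≡.refl
      where eqv = ∣evalPoly-mod P k e a≡
    Root[n]≡Root[0] : Root n ≡ Root 0
    Root[n]≡Root[0] = ≡.cong₂ (λ g w → [ g ≟ 1 ]· w) (gcd[n,n]≡gcd[0,n] n) (W-mod (n / e) (≡.sym (m/n*n≡m e∣n)))
    rootByResidue : ∀ a → W a ≡ W (a % e)
    rootByResidue a = W-mod (a / e) (m≡m%n+[m/n]*n a e)
    coprimeRoot : ∀ x → [ gcd x e ≟ 1 ]· W x ≡ [ (e ∣? ∣ evalPoly P (+ x) ∣) ×-dec (gcd x e ≟ 1) ]· 1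
    coprimeRoot x = ≡.trans ([]·-comm (gcd x e ≟ 1) (e ∣? _) 1) ([]·-× (e ∣? _) (gcd x e ≟ 1) 1)
    φn/φe≡K : divℕ (φ n) (φ e) ≡ K
    φn/φe≡K = begin
      divℕ (φ n) (φ e)              ≡⟨ ≡.cong (λ m → divℕ m (φ e)) (φ-uniformFibers n e K e-uniform) ⟩
      divℕ (φ e ℕ.* K) (φ e)        ≡⟨ divℕ-*ˡ (φ e) K ⟩
      K                             ∎

  #primeDivisors-*prime : ∀ {p j} → Prime p → ¬ p ∣ j → .{{_ : NonZero j}} →
                          length (primeDivisors (p ℕ.* j)) ≡ suc (length (primeDivisors j))
  #primeDivisors-*prime {zero}        (prime ⦃ () ⦄ _)
  #primeDivisors-*prime {p@(suc p′)} {j} p-prime p∤j = begin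
    length (primeDivisors (p ℕ.* j))
      ≡⟨ length-filter-range1 _ (p ℕ.* j) ⟩
    ∑[ i < p ℕ.* j ] ([ A i ]· 1)
      ≡⟨ ∑<-cong (p ℕ.* j) (λ i _ → []·-⊎ (A i) (B i) (suc i ≟ p) (split i) (divides-j i) (is-p i) (distinct i) 1) ⟩
    ∑[ i < p ℕ.* j ] ([ B i ]· 1 ℕ.+ [ suc i ≟ p ]· 1)
      ≡⟨ ∑<-+ (p ℕ.* j) _ _ ⟩
    ∑[ i < p ℕ.* j ] ([ B i ]· 1) ℕ.+ ∑[ i < p ℕ.* j ] ([ suc i ≟ p ]· 1)
      ≡⟨ ≡.cong₂ ℕ._+_ onlyUpTo-j onlyAt-p ⟩
    ∑[ i < j ] ([ B i ]· 1) ℕ.+ 1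
      ≡⟨ ℕ.+-comm _ 1 ⟩
    suc (∑[ i < j ] ([ B i ]· 1))
      ≡⟨ ≡.cong suc (length-filter-range1 _ j) ⟨
    suc (length (primeDivisors j)) ∎
    where
    A : ∀ i → Dec (Prime (suc i) × suc i ∣ p ℕ.* j)
    A i = prime? (suc i) ×-dec (suc i ∣? p ℕ.* j)
    B : ∀ i → Dec (Prime (suc i) × suc i ∣ j)
    B i = prime? (suc i) ×-dec (suc i ∣? j)
    split : ∀ i → Prime (suc i) × suc i ∣ p ℕ.* j → Prime (suc i) × suc i ∣ j ⊎ suc i ≡ p
    split i (q-prime , q∣pj) with euclidsLemma p j q-prime q∣pj
    ... | inj₂ q∣j = inj₁ (q-prime , q∣j)
    ... | inj₁ q∣p with prime⇒irreducible p-prime q∣p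
    ...   | inj₂ q≡p    = inj₂ q≡p
    ...   | inj₁ ≡.refl = ⊥-elim (¬prime[1] q-prime)
    divides-j : ∀ i → Prime (suc i) × suc i ∣ j → Prime (suc i) × suc i ∣ p ℕ.* j
    divides-j i (q-prime , q∣j) = q-prime , ∣n⇒∣m*n p q∣j
    is-p : ∀ i → suc i ≡ p → Prime (suc i) × suc i ∣ p ℕ.* j
    is-p i ≡.refl = p-prime , m∣m*n j
    distinct : ∀ i → Prime (suc i) × suc i ∣ j → suc i ≢ p
    distinct i (_ , q∣j) ≡.refl = p∤j q∣j
    onlyUpTo-j : ∑[ i < p ℕ.* j ] ([ B i ]· 1) ≡ ∑[ i < j ] ([ B i ]· 1)
    onlyUpTo-j = ∑<-restrict j (p ℕ.* j) _ (ℕ.m≤n*m j p)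
                   (λ i j≤i _ → []·-no (B i) (λ (_ , q∣j) → ℕ.<⇒≱ (s≤s j≤i) (∣⇒≤ q∣j)) 1)
    onlyAt-p : ∑[ i < p ℕ.* j ] ([ suc i ≟ p ]· 1) ≡ 1
    onlyAt-p = ≡.trans (∑<-single (p ℕ.* j) _ p′ (ℕ.<-≤-trans (ℕ.n<1+n p′) (ℕ.m≤m*n p j))
                         (λ i _ i≢p′ → []·-no (suc i ≟ p) (i≢p′ ∘ ℕ.suc-injective) 1))
                       ([]·-yes (p ≟ p) ≡.refl 1)

  μ-*prime-∤ : ∀ {p j} → Prime p → ¬ p ∣ j → .{{_ : NonZero j}} → μ (p ℕ.* j) ≡ ℤ.- μ j
  μ-*prime-∤ {p} {j} p-prime p∤j with squareFree⊎square j
  ... | inj₁ j-sf = begin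
    μ (p ℕ.* j)                                   ≡⟨ μ-squareFree (squareFree-*prime p-prime p∤j j-sf) ⟩
    negOnePow (length (primeDivisors (p ℕ.* j)))  ≡⟨ ≡.cong negOnePow (#primeDivisors-*prime p-prime p∤j) ⟩
    ℤ.- negOnePow (length (primeDivisors j))      ≡⟨ ≡.cong ℤ.-_ (μ-squareFree j-sf) ⟨
    ℤ.- μ j                                       ∎
  ... | inj₂ (d , 2≤d , d²∣j) =
    ≡.trans (μ-square ⦃ ℕ.m*n≢0 p j ⦄ 2≤d (∣n⇒∣m*n p d²∣j)) (≡.cong ℤ.-_ (≡.sym (μ-square 2≤d d²∣j)))
    where instance _ = prime⇒nonZero p-prime

module MöbiusInversion {c ℓ : Level} (R : CommutativeRing c ℓ) where

  open CommutativeRing R renaming (Carrier to C)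
  open FiniteSums commutativeSemiring
  open import Algebra.Properties.Ring ring using (-0#≈0#; -‿involutive; -1*x≈-x)
  open SetoidReasoning setoid

  μR : ℕ → C
  μR d = intR R (μ d)

  intR-neg : ∀ z → intR R (ℤ.- z) ≈ - intR R z
  intR-neg (+ zero)    = sym -0#≈0#
  intR-neg (+ suc k)   = refl
  intR-neg ℤ.-[1+ k ]  = sym (-‿involutive _)

  μR-*prime : ∀ {p j} → Prime p → .{{_ : NonZero j}} → μR (p ℕ.* j) ≈ [ ¬? (p ∣? j) ]· (- 1# * μR j)
  μR-*prime {p} {j} p-prime with p ∣? j
  ... | yes p∣j = reflexive (≡.cong (intR R) (μ-*prime-∣ p-prime p∣j))
  ... | no  p∤j = begin
    intR R (μ (p ℕ.* j))   ≡⟨ ≡.cong (intR R) (Counting.μ-*prime-∤ p-prime p∤j) ⟩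
    intR R (ℤ.- μ j)       ≈⟨ intR-neg (μ j) ⟩
    - μR j                 ≈⟨ -1*x≈-x _ ⟨
    - 1# * μR j            ∎

  ∑∣μ : ∀ m .{{_ : NonZero m}} → ∑[ d ∣ m ] μR d ≈ [ m ≟ 1 ]· 1#
  ∑∣μ (suc zero)       = trans (+-cong (+-identityˡ 0#) (+-identityʳ 1#)) (+-identityˡ 1#)
  ∑∣μ m@(suc (suc _)) with primeFactor m
  ... | p , p-prime , p∣m = begin
    ∑[ d ∣ m ] μR d
      ≈⟨ ∑∣-cong m (λ d _ → []·-complement (p ∣? d) (μR d)) ⟩
    ∑[ d ∣ m ] ([ ¬? (p ∣? d) ]· μR d + [ p ∣? d ]· μR d)
      ≈⟨ ∑<-cong (suc m) (λ d _ → []·-+ (d ∣? m) _ _) ⟩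
    ∑[ d < suc m ] ([ d ∣? m ]· [ ¬? (p ∣? d) ]· μR d + [ d ∣? m ]· [ p ∣? d ]· μR d)
      ≈⟨ ∑<-+ (suc m) _ _ ⟩
    ∑[ d ∣ m ] ([ ¬? (p ∣? d) ]· μR d) + ∑[ d ∣ m ] ([ p ∣? d ]· μR d)
      ≈⟨ +-cong (∑∣-prime∤ m p μR p-prime p∣m) multiplesPart ⟩
    X + - 1# * X
      ≈⟨ +-congˡ (-1*x≈-x X) ⟩
    X + - X
      ≈⟨ -‿inverseʳ X ⟩
    0# ∎
    where
    m′ = divℕ m p
    instance
      _ = prime⇒nonZero p-prime
      _ = divℕ-nonZero p∣m
    X = ∑[ d ∣ m′ ] ([ ¬? (p ∣? d) ]· μR d)
    multiplesPart : ∑[ d ∣ m ] ([ p ∣? d ]· μR d) ≈ - 1# * X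
    multiplesPart = begin
      ∑[ d ∣ m ] ([ p ∣? d ]· μR d)
        ≈⟨ ∑∣-multiples-∣ m p μR p∣m ⟩
      ∑[ j ∣ m′ ] μR (p ℕ.* j)
        ≈⟨ ∑∣-cong m′ (λ j j∣m′ → μR-*prime p-prime ⦃ ∣⇒nonZero j∣m′ ⦄) ⟩
      ∑[ j ∣ m′ ] ([ ¬? (p ∣? j) ]· (- 1# * μR j))
        ≈⟨ ∑∣-cong m′ (λ j _ → sym ([]·-*ˡ (¬? (p ∣? j)) (- 1#) (μR j))) ⟩
      ∑[ j ∣ m′ ] (- 1# * [ ¬? (p ∣? j) ]· μR j)
        ≈⟨ ∑∣-*ˡ m′ (- 1#) _ ⟩
      - 1# * X ∎

  μ-inversion : ∀ m (f : ℕ → C) .{{_ : NonZero m}} → ∑[ e ∣ m ] μconv R f e ≈ f m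
  μ-inversion m f = begin
    ∑[ e ∣ m ] μconv R f e                                             ≈⟨ ∑∣-cong m expandConv ⟩
    ∑[ e ∣ m ] ∑[ k < suc m ] ([ k ∣? e ]· (μR k * f (divℕ e k)))      ≈⟨ ∑∣-∑<-swap m (suc m) _ ⟩
    ∑[ k < suc m ] ∑[ e ∣ m ] ([ k ∣? e ]· (μR k * f (divℕ e k)))      ≈⟨ ∑<-cong (suc m) (λ k _ → ∑∣-multiples m k _) ⟩
    ∑[ k ∣ m ] ∑[ j ∣ divℕ m k ] (μR k * f (divℕ (k ℕ.* j) k))         ≈⟨ ∑∣-cong m cancel ⟩
    ∑[ k ∣ m ] ∑[ j ∣ divℕ m k ] (μR k * f j)                          ≈⟨ ∑∣∑∣-swap m (λ k j → μR k * f j) ⟩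
    ∑[ j ∣ m ] ∑[ k ∣ divℕ m j ] (μR k * f j)                          ≈⟨ ∑∣-cong m ∑∣μ*f ⟩
    ∑[ j ∣ m ] ([ divℕ m j ≟ 1 ]· f j)                                 ≈⟨ ∑∣-[m/j≡1] m f ⟩
    f m                                                                ∎
    where
    expandConv : ∀ e → e ∣ m → μconv R f e ≈ ∑[ k < suc m ] ([ k ∣? e ]· (μR k * f (divℕ e k)))
    expandConv e e∣m = trans (listSum-divisors e _) (sym (∑∣-extend e (suc m) _ (s≤s (∣⇒≤ e∣m))))
      where instance _ = ∣⇒nonZero e∣m
    cancel : ∀ k → k ∣ m → ∑[ j ∣ divℕ m k ] (μR k * f (divℕ (k ℕ.* j) k)) ≈ ∑[ j ∣ divℕ m k ] (μR k * f j)
    cancel k k∣m = ∑∣-cong (divℕ m k) (λ j _ → *-congˡ (reflexive (≡.cong f (divℕ-*ˡ k j))))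
      where instance _ = ∣⇒nonZero k∣m
    ∑∣μ*f : ∀ j → j ∣ m → ∑[ k ∣ divℕ m j ] (μR k * f j) ≈ [ divℕ m j ≟ 1 ]· f j
    ∑∣μ*f j j∣m = begin
      ∑[ k ∣ divℕ m j ] (μR k * f j)     ≈⟨ ∑∣-*ʳ (divℕ m j) (f j) μR ⟩
      ∑∣ (divℕ m j) μR * f j             ≈⟨ *-congʳ (∑∣μ (divℕ m j) ⦃ divℕ-nonZero j∣m ⦄) ⟩
      [ divℕ m j ≟ 1 ]· 1# * f j         ≈⟨ []·-*ʳ (divℕ m j ≟ 1) 1# (f j) ⟩
      [ divℕ m j ≟ 1 ]· (1# * f j)       ≈⟨ []·-congʳ (divℕ m j ≟ 1) (λ _ → *-identityˡ (f j)) ⟩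
      [ divℕ m j ≟ 1 ]· f j              ∎

module CoprimeDivisorSums {c ℓ : Level} (R : CommutativeRing c ℓ) where

  open CommutativeRing R renaming (Carrier to C)
  open FiniteSums commutativeSemiring
  open MöbiusInversion R using (μ-inversion)
  open import Algebra.Properties.Semiring.Mult semiring using (×-homo-+; ×1-homo-*) renaming (_×_ to _×′_)
  open SetoidReasoning setoid

  natR≡×1# : ∀ k → natR R k ≡ k ×′ 1#
  natR≡×1# zero    = ≡.refl
  natR≡×1# (suc k) = ≡.cong (λ x → 1# + x) (natR≡×1# k)

  natR-+ : ∀ m n → natR R (m ℕ.+ n) ≈ natR R m + natR R n
  natR-+ m n rewrite natR≡×1# (m ℕ.+ n) | natR≡×1# m | natR≡×1# n = ×-homo-+ 1# m n

  natR-* : ∀ m n → natR R (m ℕ.* n) ≈ natR R m * natR R n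
  natR-* m n rewrite natR≡×1# (m ℕ.* n) | natR≡×1# m | natR≡×1# n = ×1-homo-* m n

  natR-∑< : ∀ n (F : ℕ → ℕ) → natR R (ℕ∑.∑< n F) ≈ ∑[ i < n ] natR R (F i)
  natR-∑< zero    F = refl
  natR-∑< (suc n) F = trans (natR-+ (ℕ∑.∑< n F) (F n)) (+-congʳ (natR-∑< n F))

  natR-[]· : {P : Set} (p : Dec P) (v : ℕ) → natR R (ℕ∑.[ p ]· v) ≈ [ p ]· natR R v
  natR-[]· (yes _) v = refl
  natR-[]· (no _)  v = refl

  f∘gcd≡∑∣ : ∀ (f : ℕ → C) A n .{{_ : NonZero n}} → f (gcd A n) ≈ ∑[ e ∣ n ] ([ e ∣? A ]· μconv R f e)
  f∘gcd≡∑∣ f A n = begin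
    f (gcd A n)
      ≈⟨ μ-inversion (gcd A n) f ⟨
    ∑[ e ∣ gcd A n ] μconv R f e
      ≈⟨ ∑∣-extend (gcd A n) (suc n) _ (s≤s (gcd[m,n]≤n A n)) ⟨
    ∑[ e < suc n ] ([ e ∣? gcd A n ]· μconv R f e)
      ≈⟨ ∑<-cong (suc n) (λ e _ → commonDivisor e) ⟩
    ∑[ e ∣ n ] ([ e ∣? A ]· μconv R f e) ∎
    where
    instance _ = ℕ.≢-nonZero (gcd[m,n]≢0 A n (inj₂ (ℕ.≢-nonZero⁻¹ n)))
    commonDivisor : ∀ e → [ e ∣? gcd A n ]· μconv R f e ≈ [ e ∣? n ]· [ e ∣? A ]· μconv R f e
    commonDivisor e = trans ([]·-cong (e ∣? gcd A n) ((e ∣? n) ×-dec (e ∣? A))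
                               (λ e∣g → ∣-trans e∣g (gcd[m,n]∣n A n) , ∣-trans e∣g (gcd[m,n]∣m A n))
                               (λ (e∣n , e∣A) → gcd-greatest e∣A e∣n) refl)
                            (sym ([]·-× (e ∣? n) (e ∣? A) _))

  ∑-∑∣-count : ∀ n {U : ℕ → Set} (u : ∀ i → Dec (U i)) (A : ℕ → ℕ) (g : ℕ → C) →
               ∑[ i < n ] ([ u i ]· ∑[ e ∣ n ] ([ e ∣? A i ]· g e))
               ≈ ∑[ e ∣ n ] (g e * natR R (ℕ∑.∑< n (λ i → ℕ∑.[ u i ]· ℕ∑.[ e ∣? A i ]· 1)))
  ∑-∑∣-count n u A g = begin
    ∑[ i < n ] ([ u i ]· ∑[ e ∣ n ] ([ e ∣? A i ]· g e))
      ≈⟨ ∑<-cong n (λ i _ → trans ([]·-∑< (u i) (suc n) _) (∑<-cong (suc n) (λ e _ → []·-comm (u i) (e ∣? n) _))) ⟩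
    ∑[ i < n ] ∑[ e ∣ n ] ([ u i ]· [ e ∣? A i ]· g e)
      ≈⟨ ∑∣-∑<-swap n n _ ⟨
    ∑[ e ∣ n ] ∑[ i < n ] ([ u i ]· [ e ∣? A i ]· g e)
      ≈⟨ ∑∣-cong n (λ e _ → count e) ⟩
    ∑[ e ∣ n ] (g e * natR R (ℕ∑.∑< n (λ i → ℕ∑.[ u i ]· ℕ∑.[ e ∣? A i ]· 1))) ∎
    where
    indicator : ∀ i e → [ u i ]· [ e ∣? A i ]· g e ≈ g e * natR R (ℕ∑.[ u i ]· ℕ∑.[ e ∣? A i ]· 1)
    indicator i e = begin
      [ u i ]· [ e ∣? A i ]· g e
        ≈⟨ []·-congʳ (u i) (λ _ → []·-congʳ (e ∣? A i) (λ _ → *-identityʳ (g e))) ⟨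
      [ u i ]· [ e ∣? A i ]· (g e * 1#)
        ≈⟨ []·-congʳ (u i) (λ _ → []·-*ˡ (e ∣? A i) (g e) 1#) ⟨
      [ u i ]· (g e * [ e ∣? A i ]· 1#)
        ≈⟨ []·-*ˡ (u i) (g e) _ ⟨
      g e * [ u i ]· [ e ∣? A i ]· 1#
        ≈⟨ *-congˡ ([]·-congʳ (u i) (λ _ → []·-congʳ (e ∣? A i) (λ _ → +-identityʳ 1#))) ⟨
      g e * [ u i ]· [ e ∣? A i ]· natR R 1
        ≈⟨ *-congˡ (trans (natR-[]· (u i) _) ([]·-congʳ (u i) (λ _ → natR-[]· (e ∣? A i) 1))) ⟨
      g e * natR R (ℕ∑.[ u i ]· ℕ∑.[ e ∣? A i ]· 1) ∎
    count : ∀ e → ∑[ i < n ] ([ u i ]· [ e ∣? A i ]· g e) ≈ g e * natR R (ℕ∑.∑< n (λ i → ℕ∑.[ u i ]· ℕ∑.[ e ∣? A i ]· 1))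
    count e = begin
      ∑[ i < n ] ([ u i ]· [ e ∣? A i ]· g e)                          ≈⟨ ∑<-cong n (λ i _ → indicator i e) ⟩
      ∑[ i < n ] (g e * natR R (ℕ∑.[ u i ]· ℕ∑.[ e ∣? A i ]· 1))       ≈⟨ ∑<-*ˡ n (g e) _ ⟩
      g e * ∑[ i < n ] natR R (ℕ∑.[ u i ]· ℕ∑.[ e ∣? A i ]· 1)         ≈⟨ *-congˡ (natR-∑< n _) ⟨
      g e * natR R (ℕ∑.∑< n (λ i → ℕ∑.[ u i ]· ℕ∑.[ e ∣? A i ]· 1))    ∎

  ∑-coprime-f∘gcd : ∀ (f : ℕ → C) P n .{{_ : NonZero n}} →
    ∑[ i < n ] ([ gcd (suc i) n ≟ 1 ]· f (gcd ∣ evalPoly P (+ suc i) ∣ n))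
    ≈ ∑[ e ∣ n ] (natR R (divℕ (φ n) (φ e)) * (μconv R f e * natR R (NP P e)))
  ∑-coprime-f∘gcd f P n = begin
    ∑[ i < n ] ([ unit (suc i) ]· f (gcd (A (suc i)) n))
      ≈⟨ ∑<-cong n (λ i _ → []·-congʳ (unit (suc i)) (λ _ → f∘gcd≡∑∣ f (A (suc i)) n)) ⟩
    ∑[ i < n ] ([ unit (suc i) ]· ∑[ e ∣ n ] ([ e ∣? A (suc i) ]· g e))
      ≈⟨ ∑-∑∣-count n (unit ∘ suc) (A ∘ suc) g ⟩
    ∑[ e ∣ n ] (g e * natR R (count e))
      ≈⟨ ∑∣-cong n (λ e e∣n → rearrange e (Counting.coprimeRootCount n e P e∣n)) ⟩
    ∑[ e ∣ n ] (natR R (divℕ (φ n) (φ e)) * (g e * natR R (NP P e))) ∎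
    where
    open CommutativeSemigroupProperties *-commutativeSemigroup using (x∙yz≈y∙xz)
    unit = λ a → gcd a n ≟ 1
    A = λ a → ∣ evalPoly P (+ a) ∣
    g = μconv R f
    count = λ e → ℕ∑.∑< n (λ i → ℕ∑.[ unit (suc i) ]· ℕ∑.[ e ∣? A (suc i) ]· 1)
    rearrange : ∀ e → count e ≡ divℕ (φ n) (φ e) ℕ.* NP P e →
                g e * natR R (count e) ≈ natR R (divℕ (φ n) (φ e)) * (g e * natR R (NP P e))
    rearrange e count≡ = begin
      g e * natR R (count e)                                  ≡⟨ ≡.cong (λ k → g e * natR R k) count≡ ⟩
      g e * natR R (divℕ (φ n) (φ e) ℕ.* NP P e)              ≈⟨ *-congˡ (natR-* (divℕ (φ n) (φ e)) (NP P e)) ⟩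
      g e * (natR R (divℕ (φ n) (φ e)) * natR R (NP P e))     ≈⟨ x∙yz≈y∙xz _ _ _ ⟩
      natR R (divℕ (φ n) (φ e)) * (g e * natR R (NP P e))     ∎

theorem7 : {c ℓ : Level} (R : CommutativeRing c ℓ)
    (f : ℕ → CommutativeRing.Carrier R) (P : List ℤ) (n : ℕ) → NonZero n →
    CommutativeRing._≈_ R
      (sumR R (map (λ a → f (gcd ∣ evalPoly P (+ a) ∣ n))
                   (filter (λ a → gcd a n ≟ 1) (range1 n))))
      (sumR R (map (λ d → CommutativeRing._*_ R (natR R (divℕ (φ n) (φ d)))
                             (CommutativeRing._*_ R (μconv R f d) (natR R (NP P d))))
                   (divisors n)))
theorem7 R f P n n≢0 = begin
  listSum (filter unit (range1 n)) F                      ≈⟨ listSum-filter unit (range1 n) F ⟩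
  listSum (range1 n) (λ a → [ unit a ]· F a)              ≈⟨ listSum-range1 n _ ⟩
  ∑[ i < n ] ([ unit (suc i) ]· F (suc i))                ≈⟨ ∑-coprime-f∘gcd f P n ⟩
  ∑∣ n (λ e → natR R (divℕ (φ n) (φ e)) * (μconv R f e * natR R (NP P e)))
                                                          ≈⟨ listSum-divisors n _ ⟨
  listSum (divisors n) (λ e → natR R (divℕ (φ n) (φ e)) * (μconv R f e * natR R (NP P e))) ∎
  where
  instance _ = n≢0
  open CommutativeRing R
  open FiniteSums commutativeSemiring
  open CoprimeDivisorSums R using (∑-coprime-f∘gcd)
  open SetoidReasoning setoid
  unit = λ a → gcd a n ≟ 1
  F = λ a → f (gcd ∣ evalPoly P (+ a) ∣ n)
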